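{- Let $n \ge 3$, let $\lambda \vdash n$, and let $p$ and $q$ denote the number of parts of $\lambda$ equal to $1$ and to $2$, respectively. For $1 \le i < j \le n$ let \[ I_\lambda(i,j) = \#\{\pi \in C_\lambda \mid \pi(i) > \pi(j)\}. \] Then \[ I_\lambda(i,j) = \frac{\#C_\lambda}{2}\left(1 + \frac{2q - p(p-1)}{n(n-1)} + \frac{2(j-i-1)\big((n-p)(1-p) - 2q\big)}{n(n-1)(n-2)}\right). \]
   Context: $C_\lambda \subseteq \mathfrak{S}_n$ denotes the conjugacy class of permutations of $[n]$ whose cycle type is the partition $\lambda$. -}

module Defs where

open import Data.Nat using (ℕ; zero; suc; _+_; _*_; _∸_; _≤_; _<_; _<ᵇ_; NonZero; s≤s; z≤n)
open import Data.Nat.Properties using (≤-decTotalOrder)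
import Data.Nat as ℕ
open import Data.Fin using (Fin; toℕ; zero; suc)
import Data.Fin as Fin
open import Data.List using (List; []; _∷_; [_]; map; concatMap; filter; length; upTo; allFin)
open import Data.Nat.ListAction using (sum)
open import Data.List.Properties using (≡-dec)
open import Data.List.Relation.Unary.All using (All)
open import Data.List.Relation.Unary.All as All using (all?)
open import Data.Bool using (Bool; true; false; if_then_else_)
open import Function using (_∘_)
open import Relation.Nullary using (Dec; yes; no; ¬_)
open import Relation.Nullary.Decidable using (_×-dec_; ¬?)
open import Relation.Binary.PropositionalEquality using (_≡_; refl)
open import Data.Product using (_×_; _,_)
open import Data.List.Sort.InsertionSort ≤-decTotalOrder using (sort)
open import Data.List.Relation.Unary.Sorted.TotalOrder (Data.Nat.Properties.≤-totalOrder) using (Sorted)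

extend : ∀ {m n} → Fin n → (Fin m → Fin n) → (Fin (suc m) → Fin n)
extend y f zero    = y
extend y f (suc i) = f i

allFuns : (m n : ℕ) → List (Fin m → Fin n)
allFuns zero    n = [ (λ ()) ]
allFuns (suc m) n = concatMap (λ f → map (λ y → extend y f) (allFin n)) (allFuns m n)

IsInjective : ∀ {n} → (Fin n → Fin n) → Set
IsInjective {n} f = All (λ x → All (λ y → f x ≡ f y → x ≡ y) (allFin n)) (allFin n)

isInjective? : ∀ {n} (f : Fin n → Fin n) → Dec (IsInjective f)
isInjective? {n} f = all? (λ x → all? (λ y → dec x y) (allFin n)) (allFin n)
  where
  dec : ∀ x y → Dec (f x ≡ f y → x ≡ y)
  dec x y with f x Fin.≟ f y | x Fin.≟ y
  ... | _      | yes e = yes (λ _ → e)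
  ... | yes e  | no ne = no (λ h → ne (h e))
  ... | no ne  | no _  = yes (λ e → Data.Empty.⊥-elim (ne e))
    where import Data.Empty

-- The symmetric group S_n, enumerated as a list of (bijective) maps Fin n → Fin n
-- (an injective self-map of a finite set is a permutation). [n] = {1,…,n} is
-- modelled by Fin n = {0,…,n-1}.
Sym : (n : ℕ) → List (Fin n → Fin n)
Sym n = filter isInjective? (allFuns n n)

iter : ∀ {n} → (Fin n → Fin n) → ℕ → Fin n → Fin n
iter π zero    x = x
iter π (suc k) x = π (iter π k x)

-- least k ∈ {1,…,n} with π^k(x) = x  (the length of the cycle of π through x;
-- for a permutation of Fin n it always exists and is ≤ n)
orderFrom : ∀ {n} → (Fin n → Fin n) → Fin n → (k fuel : ℕ) → ℕ
orderFrom π x k zero = k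
orderFrom π x k (suc fuel) with iter π k x Fin.≟ x
... | yes _ = k
... | no  _ = orderFrom π x (suc k) fuel

cycLen : ∀ {n} → (Fin n → Fin n) → Fin n → ℕ
cycLen {n} π x = orderFrom π x 1 n

IsCycleMin : ∀ {n} → (Fin n → Fin n) → Fin n → Set
IsCycleMin {n} π x = All (λ k → x Fin.≤ iter π k x) (upTo n)

isCycleMin? : ∀ {n} (π : Fin n → Fin n) (x : Fin n) → Dec (IsCycleMin π x)
isCycleMin? {n} π x = all? (λ k → x Fin.≤? iter π k x) (upTo n)

-- cycle type of π: the multiset of its cycle lengths (one entry per cycle,
-- each cycle represented by its least element), listed in nondecreasing order
cycleType : ∀ {n} → (Fin n → Fin n) → List ℕ
cycleType {n} π = sort (map (cycLen π) (filter (isCycleMin? π) (allFin n)))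

record _⊢_ (lam : List ℕ) (n : ℕ) : Set where
  field
    positive : All (λ k → 0 < k) lam
    sorted   : Sorted lam
    total    : sum lam ≡ n

mult : ℕ → List ℕ → ℕ
mult k lam = length (filter (λ x → x ℕ.≟ k) lam)

C : (n : ℕ) → List ℕ → List (Fin n → Fin n)
C n lam = filter (λ π → ≡-dec ℕ._≟_ (cycleType π) lam) (Sym n)

I : (n : ℕ) → List ℕ → Fin n → Fin n → ℕ
I n lam i j = length (filter (λ π → π j Fin.<? π i) (C n lam))

nz₂ : ∀ n → 3 ≤ n → NonZero (n * (n ∸ 1))
nz₂ (suc (suc (suc m))) _ = _
nz₂ (suc (suc zero)) (s≤s (s≤s ()))
nz₂ (suc zero) (s≤s ())

nz₃ : ∀ n → 3 ≤ n → NonZero (n * (n ∸ 1) * (n ∸ 2))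
nz₃ (suc (suc (suc m))) _ = _
nz₃ (suc (suc zero)) (s≤s (s≤s ()))
nz₃ (suc zero) (s≤s ())

module Submission where

-- Write F = #C_λ. Conjugation by a transposition maps C_λ onto itself, so the numbers of π ∈ C_λ with
-- π(x) = a, with π(x) = a and π(y) = b, or with π(π(x)) = x depend only on which of the points involved
-- coincide. Summing such a count over one free point and splitting off the exceptional terms yields linear
-- relations among them; the remaining sums count fixed points and points on 2-cycles, i.e. p and p + 2q.
-- Conjugation by the adjacent transposition (j j+1) changes whether π(i) > π(j) exactly for the π mapping
-- {i, j} onto {j, j+1}, so I(i, j+1) − I(i, j) is a difference of two such counts and does not depend on j.
-- With I(i, i+1) + I(i+1, i) = F, this makes I(i, j) an affine function of j − i with the stated coefficients.

open import Level using (Level)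
open import Algebra.Definitions using (Involutive)
open import Data.Empty using (⊥-elim)
open import Data.Fin as Fin using (Fin; toℕ; fromℕ<)
import Data.Fin.Properties as Finₚ
open import Data.Fin.Permutation.Components using (transpose)
open import Data.List using (List; []; _∷_; _++_; map; concatMap; filter; length; allFin; upTo)
open import Data.List.Properties using (length-tabulate; map-tabulate; map-cong; filter-≐; ≡-dec)
open import Data.List.Membership.Propositional.Properties using (∈-allFin; ∈-upTo⁺)
open import Data.List.Relation.Unary.All as All using (All)
import Data.List.Relation.Unary.All.Properties as Allₚ
import Data.List.Relation.Unary.Linked as Linked
open import Data.List.Relation.Unary.Linked.Properties using (Linked⇒All)
open import Data.List.Relation.Binary.Permutation.Propositional.Properties using (↭-length; filter-↭)
open import Data.Nat as ℕ using (ℕ; zero; suc; _+_; _*_; _∸_; _≤_; _<_; z≤n; s≤s; >-nonZero)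
open import Data.Nat.Properties
open import Data.Nat.DivMod using (_%_; m≡m%n+[m/n]*n; m%n<n)
open import Data.List.Sort.InsertionSort ≤-decTotalOrder using (sort)
open import Data.List.Sort.InsertionSort.Properties ≤-decTotalOrder using (sort-↭; sort-↗)
open import Data.List.Relation.Unary.Sorted.TotalOrder ≤-totalOrder using (Sorted)
open import Data.Product using (∃; _×_; _,_; proj₁; proj₂)
open import Data.Sum using (_⊎_; inj₁; inj₂)
open import Function using (_∘_; id)
open import Function.Definitions using (Injective)
open import Relation.Nullary using (Dec; yes; no; ¬_; contradiction)
open import Relation.Nullary.Decidable using (_×-dec_)
open import Relation.Unary using (Pred; Decidable)
open import Relation.Binary.Definitions using (tri<; tri≈; tri>)
open import Relation.Binary.PropositionalEquality
open import Algebra.Properties.CommutativeSemigroup +-commutativeSemigroup using () renaming (interchange to +-interchange)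
open import Algebra.Properties.CommutativeSemigroup *-commutativeSemigroup using (x∙yz≈y∙xz)
open import Defs

private variable
  a ℓ : Level
  A B : Set a
  P Q R : Set ℓ

𝟙 : Dec P → ℕ
𝟙 (yes _) = 1
𝟙 (no _)  = 0

𝟙-yes : (d : Dec P) → P → 𝟙 d ≡ 1
𝟙-yes (yes _) _  = refl
𝟙-yes (no ¬p) p = ⊥-elim (¬p p)

𝟙-no : (d : Dec P) → ¬ P → 𝟙 d ≡ 0
𝟙-no (yes p) ¬p = ⊥-elim (¬p p)
𝟙-no (no _)  _  = refl

𝟙-cong : (d : Dec P) (e : Dec Q) → (P → Q) → (Q → P) → 𝟙 d ≡ 𝟙 e
𝟙-cong d (yes q) _ g = 𝟙-yes d (g q)
𝟙-cong d (no ¬q) f _ = 𝟙-no d (¬q ∘ f)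

𝟙-× : (c : Dec R) (d : Dec P) (e : Dec Q) → (R → P) → (R → Q) → (P → Q → R) → 𝟙 c ≡ 𝟙 d * 𝟙 e
𝟙-× (yes r) d e f g _ rewrite 𝟙-yes d (f r) | 𝟙-yes e (g r) = refl
𝟙-× (no ¬r) (yes p) e _ _ h = sym (trans (+-identityʳ (𝟙 e)) (𝟙-no e (¬r ∘ h p)))
𝟙-× (no ¬r) (no _)  e _ _ _ = refl

𝟙-idem : (d : Dec P) → 𝟙 d * 𝟙 d ≡ 𝟙 d
𝟙-idem d = sym (𝟙-× d d d (λ x → x) (λ x → x) (λ x _ → x))

𝟙-≟-sym : ∀ {n} (x y : Fin n) → 𝟙 (x Fin.≟ y) ≡ 𝟙 (y Fin.≟ x)
𝟙-≟-sym x y = 𝟙-cong (x Fin.≟ y) (y Fin.≟ x) sym sym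

∑ : List A → (A → ℕ) → ℕ
∑ []       w = 0
∑ (x ∷ xs) w = w x + ∑ xs w

syntax ∑ xs (λ x → e) = ∑[ x ∈ xs ] e

∑-cong : ∀ (xs : List A) {w v : A → ℕ} → (∀ x → w x ≡ v x) → ∑ xs w ≡ ∑ xs v
∑-cong []       _ = refl
∑-cong (x ∷ xs) e = cong₂ _+_ (e x) (∑-cong xs e)

∑-cong-All : ∀ {xs : List A} {w v : A → ℕ} → All (λ x → w x ≡ v x) xs → ∑ xs w ≡ ∑ xs v
∑-cong-All All.[]       = refl
∑-cong-All (e All.∷ es) = cong₂ _+_ e (∑-cong-All es)

∑-+ : ∀ (xs : List A) (w v : A → ℕ) → ∑[ x ∈ xs ] (w x + v x) ≡ ∑ xs w + ∑ xs v
∑-+ []       w v = refl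
∑-+ (x ∷ xs) w v = trans (cong (w x + v x +_) (∑-+ xs w v)) (+-interchange (w x) (v x) (∑ xs w) (∑ xs v))

∑-*ˡ : ∀ (xs : List A) c (w : A → ℕ) → ∑[ x ∈ xs ] (c * w x) ≡ c * ∑ xs w
∑-*ˡ []       c w = sym (*-zeroʳ c)
∑-*ˡ (x ∷ xs) c w = trans (cong (c * w x +_) (∑-*ˡ xs c w)) (sym (*-distribˡ-+ c (w x) (∑ xs w)))

∑-*ʳ : ∀ (xs : List A) c (w : A → ℕ) → ∑[ x ∈ xs ] (w x * c) ≡ ∑ xs w * c
∑-*ʳ []       c w = refl
∑-*ʳ (x ∷ xs) c w = trans (cong (w x * c +_) (∑-*ʳ xs c w)) (sym (*-distribʳ-+ c (w x) (∑ xs w)))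

∑-const : ∀ (xs : List A) c → ∑[ _ ∈ xs ] c ≡ length xs * c
∑-const []       c = refl
∑-const (x ∷ xs) c = cong (c +_) (∑-const xs c)

∑-zero : ∀ (xs : List A) → ∑[ _ ∈ xs ] 0 ≡ 0
∑-zero xs = trans (∑-const xs 0) (*-zeroʳ (length xs))

∑-swap : ∀ (xs : List A) (ys : List B) (w : A → B → ℕ) →
         ∑[ x ∈ xs ] ∑[ y ∈ ys ] w x y ≡ ∑[ y ∈ ys ] ∑[ x ∈ xs ] w x y
∑-swap []       ys w = sym (∑-zero ys)
∑-swap (x ∷ xs) ys w = trans (cong (∑ ys (w x) +_) (∑-swap xs ys w)) (sym (∑-+ ys (w x) _))

∑-++ : ∀ (xs ys : List A) w → ∑ (xs ++ ys) w ≡ ∑ xs w + ∑ ys w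
∑-++ []       ys w = refl
∑-++ (x ∷ xs) ys w = trans (cong (w x +_) (∑-++ xs ys w)) (sym (+-assoc (w x) _ _))

∑-map : ∀ (f : B → A) (xs : List B) w → ∑ (map f xs) w ≡ ∑ xs (w ∘ f)
∑-map f []       w = refl
∑-map f (x ∷ xs) w = cong (w (f x) +_) (∑-map f xs w)

∑-concatMap : ∀ (f : B → List A) (xs : List B) w → ∑ (concatMap f xs) w ≡ ∑[ y ∈ xs ] ∑ (f y) w
∑-concatMap f []       w = refl
∑-concatMap f (x ∷ xs) w = trans (∑-++ (f x) (concatMap f xs) w) (cong (∑ (f x) w +_) (∑-concatMap f xs w))

∑-filter : ∀ {P : Pred A ℓ} (P? : Decidable P) xs w → ∑ (filter P? xs) w ≡ ∑[ x ∈ xs ] (𝟙 (P? x) * w x)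
∑-filter P? []       w = refl
∑-filter P? (x ∷ xs) w with P? x
... | yes _ = cong₂ _+_ (sym (+-identityʳ (w x))) (∑-filter P? xs w)
... | no _  = ∑-filter P? xs w

length-filter : ∀ {P : Pred A ℓ} (P? : Decidable P) xs → length (filter P? xs) ≡ ∑[ x ∈ xs ] 𝟙 (P? x)
length-filter P? []       = refl
length-filter P? (x ∷ xs) with P? x
... | yes _ = cong suc (length-filter P? xs)
... | no _  = length-filter P? xs

∑-allFin-suc : ∀ n (w : Fin (suc n) → ℕ) → ∑ (allFin (suc n)) w ≡ w Fin.zero + ∑ (allFin n) (w ∘ Fin.suc)
∑-allFin-suc n w = cong (w Fin.zero +_) (trans (cong (λ xs → ∑ xs w) (sym (map-tabulate id Fin.suc))) (∑-map Fin.suc (allFin n) w))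

∑-allFin-const : ∀ n c → ∑[ _ ∈ allFin n ] c ≡ n * c
∑-allFin-const n c = trans (∑-const (allFin n) c) (cong (_* c) (length-tabulate {n = n} id))

∑-pick : ∀ n (y : Fin n) (w : Fin n → ℕ) → ∑[ x ∈ allFin n ] (𝟙 (x Fin.≟ y) * w x) ≡ w y
∑-pick (suc n) Fin.zero w = begin
  ∑[ x ∈ allFin (suc n) ] (𝟙 (x Fin.≟ Fin.zero) * w x)  ≡⟨ ∑-allFin-suc n (λ x → 𝟙 (x Fin.≟ Fin.zero) * w x) ⟩
  1 * w Fin.zero + ∑[ x ∈ allFin n ] 0                  ≡⟨ cong₂ _+_ (*-identityˡ _) (∑-zero (allFin n)) ⟩
  w Fin.zero + 0                                        ≡⟨ +-identityʳ _ ⟩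
  w Fin.zero                                            ∎
  where open ≡-Reasoning
∑-pick (suc n) (Fin.suc y) w = begin
  ∑[ x ∈ allFin (suc n) ] (𝟙 (x Fin.≟ Fin.suc y) * w x)      ≡⟨ ∑-allFin-suc n (λ x → 𝟙 (x Fin.≟ Fin.suc y) * w x) ⟩
  ∑[ x ∈ allFin n ] (𝟙 (Fin.suc x Fin.≟ Fin.suc y) * w (Fin.suc x))
    ≡⟨ ∑-cong (allFin n) (λ x → cong (_* w (Fin.suc x)) (𝟙-suc x)) ⟩
  ∑[ x ∈ allFin n ] (𝟙 (x Fin.≟ y) * w (Fin.suc x))          ≡⟨ ∑-pick n y (w ∘ Fin.suc) ⟩
  w (Fin.suc y)                                             ∎
  where
  open ≡-Reasoning
  𝟙-suc : ∀ x → 𝟙 (Fin.suc x Fin.≟ Fin.suc y) ≡ 𝟙 (x Fin.≟ y)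
  𝟙-suc x = 𝟙-cong (Fin.suc x Fin.≟ Fin.suc y) (x Fin.≟ y) Finₚ.suc-injective (cong Fin.suc)

∑-𝟙-≟ : ∀ n (y : Fin n) → ∑[ x ∈ allFin n ] 𝟙 (x Fin.≟ y) ≡ 1
∑-𝟙-≟ n y = trans (∑-cong (allFin n) (λ x → sym (*-identityʳ _))) (∑-pick n y (λ _ → 1))

∑-𝟙-≟′ : ∀ n (y : Fin n) → ∑[ x ∈ allFin n ] 𝟙 (y Fin.≟ x) ≡ 1
∑-𝟙-≟′ n y = trans (∑-cong (allFin n) (𝟙-≟-sym y)) (∑-𝟙-≟ n y)

∑-pick′ : ∀ n (y : Fin n) (w : Fin n → ℕ) → ∑[ x ∈ allFin n ] (𝟙 (y Fin.≟ x) * w x) ≡ w y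
∑-pick′ n y w = trans (∑-cong (allFin n) (λ x → cong (_* w x) (𝟙-≟-sym y x))) (∑-pick n y w)

∑-all-but-one : ∀ n (f : Fin n → ℕ) i c → (∀ y → y ≢ i → f y ≡ c) → ∑ (allFin n) f + c ≡ f i + n * c
∑-all-but-one n f i c f≡c = begin
  ∑ (allFin n) f + c                                          ≡⟨ cong (∑ (allFin n) f +_) (∑-pick n i (λ _ → c)) ⟨
  ∑ (allFin n) f + ∑[ y ∈ allFin n ] (𝟙 (y Fin.≟ i) * c)      ≡⟨ ∑-+ (allFin n) f _ ⟨
  ∑[ y ∈ allFin n ] (f y + 𝟙 (y Fin.≟ i) * c)                 ≡⟨ ∑-cong (allFin n) (λ y → exchange y (y Fin.≟ i)) ⟩
  ∑[ y ∈ allFin n ] (𝟙 (y Fin.≟ i) * f i + c)                 ≡⟨ ∑-+ (allFin n) _ _ ⟩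
  ∑[ y ∈ allFin n ] (𝟙 (y Fin.≟ i) * f i) + ∑[ _ ∈ allFin n ] c ≡⟨ cong₂ _+_ (∑-pick n i (λ _ → f i)) (∑-allFin-const n c) ⟩
  f i + n * c                                                 ∎
  where
  open ≡-Reasoning
  exchange : ∀ y (d : Dec (y ≡ i)) → f y + 𝟙 d * c ≡ 𝟙 d * f i + c
  exchange y (yes refl) = cong₂ _+_ (sym (+-identityʳ (f y))) (+-identityʳ c)
  exchange y (no y≢i)   = trans (+-identityʳ (f y)) (f≡c y y≢i)

∑-all-but-two : ∀ n (f : Fin n → ℕ) i j c → i ≢ j → (∀ y → y ≢ i → y ≢ j → f y ≡ c) →
                ∑ (allFin n) f + 2 * c ≡ f i + f j + n * c
∑-all-but-two n f i j c i≢j f≡c = begin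
  ∑ (allFin n) f + 2 * c                                              ≡⟨ cong (∑ (allFin n) f +_) two-points ⟨
  ∑ (allFin n) f + ∑[ y ∈ allFin n ] (𝟙 (y Fin.≟ i) * c + 𝟙 (y Fin.≟ j) * c) ≡⟨ ∑-+ (allFin n) f _ ⟨
  ∑[ y ∈ allFin n ] (f y + (𝟙 (y Fin.≟ i) * c + 𝟙 (y Fin.≟ j) * c))
    ≡⟨ ∑-cong (allFin n) (λ y → exchange y (y Fin.≟ i) (y Fin.≟ j)) ⟩
  ∑[ y ∈ allFin n ] (𝟙 (y Fin.≟ i) * f i + (𝟙 (y Fin.≟ j) * f j + c)) ≡⟨ ∑-+ (allFin n) _ _ ⟩
  ∑[ y ∈ allFin n ] (𝟙 (y Fin.≟ i) * f i) + ∑[ y ∈ allFin n ] (𝟙 (y Fin.≟ j) * f j + c)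
    ≡⟨ cong₂ _+_ (∑-pick n i (λ _ → f i)) (∑-+ (allFin n) _ _) ⟩
  f i + (∑[ y ∈ allFin n ] (𝟙 (y Fin.≟ j) * f j) + ∑[ _ ∈ allFin n ] c)
    ≡⟨ cong (f i +_) (cong₂ _+_ (∑-pick n j (λ _ → f j)) (∑-allFin-const n c)) ⟩
  f i + (f j + n * c)                                                 ≡⟨ +-assoc (f i) (f j) (n * c) ⟨
  f i + f j + n * c                                                   ∎
  where
  open ≡-Reasoning
  two-points : ∑[ y ∈ allFin n ] (𝟙 (y Fin.≟ i) * c + 𝟙 (y Fin.≟ j) * c) ≡ 2 * c
  two-points = trans (∑-+ (allFin n) _ _) (trans (cong₂ _+_ (∑-pick n i (λ _ → c)) (∑-pick n j (λ _ → c))) (cong (c +_) (sym (+-identityʳ c))))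
  exchange : ∀ y (d : Dec (y ≡ i)) (e : Dec (y ≡ j)) →
             f y + (𝟙 d * c + 𝟙 e * c) ≡ 𝟙 d * f i + (𝟙 e * f j + c)
  exchange y (yes refl) (yes refl) = ⊥-elim (i≢j refl)
  exchange y (yes refl) (no _)     = cong₂ _+_ (sym (+-identityʳ (f y))) (trans (+-identityʳ _) (+-identityʳ c))
  exchange y (no _)     (yes refl) = trans (cong (f y +_) (+-identityʳ c)) (cong (_+ c) (sym (+-identityʳ (f y))))
  exchange y (no y≢i)   (no y≢j)   = trans (+-identityʳ (f y)) (f≡c y y≢i y≢j)

-- xs lists every element exactly once up to ≈, and s is an involution up to ≈.
module _ (xs : List A) (_≈_ : A → A → Set ℓ) (_≈?_ : ∀ x y → Dec (x ≈ y))
         (once : ∀ y → ∑[ x ∈ xs ] 𝟙 (x ≈? y) ≡ 1) where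

  ∑-involution : (s : A → A) → (∀ x y → y ≈ s x → x ≈ s y) →
                 (w : A → ℕ) → (∀ x y → x ≈ y → w x ≡ w y) → ∑ xs w ≡ ∑ xs (w ∘ s)
  ∑-involution s s-inv w w-resp = begin
    ∑[ x ∈ xs ] w x                                        ≡⟨ ∑-cong xs (λ x → sym (weigh x)) ⟩
    ∑[ x ∈ xs ] ∑[ y ∈ xs ] (𝟙 (y ≈? s x) * w x)           ≡⟨ ∑-swap xs xs _ ⟩
    ∑[ y ∈ xs ] ∑[ x ∈ xs ] (𝟙 (y ≈? s x) * w x)           ≡⟨ ∑-cong xs (λ y → ∑-cong xs (λ x → transfer x y)) ⟩
    ∑[ y ∈ xs ] ∑[ x ∈ xs ] (𝟙 (x ≈? s y) * w (s y))
      ≡⟨ ∑-cong xs (λ y → trans (∑-*ʳ xs _ _) (cong (_* w (s y)) (once (s y)))) ⟩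
    ∑[ y ∈ xs ] (1 * w (s y))                              ≡⟨ ∑-cong xs (λ y → *-identityˡ _) ⟩
    ∑[ y ∈ xs ] w (s y)                                    ∎
    where
    open ≡-Reasoning
    weigh : ∀ x → ∑[ y ∈ xs ] (𝟙 (y ≈? s x) * w x) ≡ w x
    weigh x = trans (∑-*ʳ xs _ _) (trans (cong (_* w x) (once (s x))) (*-identityˡ _))
    transfer : ∀ x y → 𝟙 (y ≈? s x) * w x ≡ 𝟙 (x ≈? s y) * w (s y)
    transfer x y with x ≈? s y
    ... | yes x≈sy = cong₂ _*_ (𝟙-yes (y ≈? s x) (s-inv y x x≈sy)) (w-resp x (s y) x≈sy)
    ... | no x≉sy  = cong (_* w x) (𝟙-no (y ≈? s x) (x≉sy ∘ s-inv x y))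

∑-allFin-involution : ∀ n (s : Fin n → Fin n) → Involutive _≡_ s → (w : Fin n → ℕ) → ∑ (allFin n) w ≡ ∑ (allFin n) (w ∘ s)
∑-allFin-involution n s s-inv w =
  ∑-involution (allFin n) _≡_ Fin._≟_ (∑-𝟙-≟ n) s (λ x y y≡sx → trans (sym (s-inv x)) (cong s (sym y≡sx))) w (λ _ _ → cong w)

_≗?_ : ∀ {m n} (f g : Fin m → Fin n) → Dec (f ≗ g)
f ≗? g = Finₚ.all? (λ x → f x Fin.≟ g x)

allFuns-once : ∀ m n (f : Fin m → Fin n) → ∑[ g ∈ allFuns m n ] 𝟙 (g ≗? f) ≡ 1
allFuns-once zero    n f = refl
allFuns-once (suc m) n f = begin
  ∑[ g ∈ allFuns (suc m) n ] 𝟙 (g ≗? f)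
    ≡⟨ ∑-concatMap _ (allFuns m n) _ ⟩
  ∑[ g ∈ allFuns m n ] ∑ (map (λ y → extend y g) (allFin n)) (λ g′ → 𝟙 (g′ ≗? f))
    ≡⟨ ∑-cong (allFuns m n) (λ g → ∑-map _ (allFin n) _) ⟩
  ∑[ g ∈ allFuns m n ] ∑[ y ∈ allFin n ] 𝟙 (extend y g ≗? f)
    ≡⟨ ∑-cong (allFuns m n) (λ g → ∑-cong (allFin n) (λ y → 𝟙-extend y g)) ⟩
  ∑[ g ∈ allFuns m n ] ∑[ y ∈ allFin n ] (𝟙 (y Fin.≟ f Fin.zero) * 𝟙 (g ≗? (f ∘ Fin.suc)))
    ≡⟨ ∑-cong (allFuns m n) (λ g → ∑-pick n (f Fin.zero) _) ⟩
  ∑[ g ∈ allFuns m n ] 𝟙 (g ≗? (f ∘ Fin.suc))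
    ≡⟨ allFuns-once m n (f ∘ Fin.suc) ⟩
  1 ∎
  where
  open ≡-Reasoning
  𝟙-extend : ∀ y g → 𝟙 (extend y g ≗? f) ≡ 𝟙 (y Fin.≟ f Fin.zero) * 𝟙 (g ≗? (f ∘ Fin.suc))
  𝟙-extend y g = 𝟙-× (extend y g ≗? f) (y Fin.≟ f Fin.zero) (g ≗? (f ∘ Fin.suc))
    (λ e → e Fin.zero) (λ e → e ∘ Fin.suc) (λ { e₀ e₊ Fin.zero → e₀ ; e₀ e₊ (Fin.suc x) → e₊ x })

transpose-matchˡ : ∀ {n} (i j : Fin n) → transpose i j i ≡ j
transpose-matchˡ i j with i Fin.≟ i
... | yes _   = refl
... | no i≢i = ⊥-elim (i≢i refl)

transpose-matchʳ : ∀ {n} (i j : Fin n) → transpose i j j ≡ i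
transpose-matchʳ i j with j Fin.≟ i
... | yes j≡i = j≡i
... | no _ with j Fin.≟ j
...   | yes _   = refl
...   | no j≢j = ⊥-elim (j≢j refl)

transpose-mismatch : ∀ {n} {i j k : Fin n} → k ≢ i → k ≢ j → transpose i j k ≡ k
transpose-mismatch {i = i} {j} {k} k≢i k≢j with k Fin.≟ i
... | yes k≡i = ⊥-elim (k≢i k≡i)
... | no _ with k Fin.≟ j
...   | yes k≡j = ⊥-elim (k≢j k≡j)
...   | no _    = refl

transpose-involutive : ∀ {n} (i j : Fin n) → Involutive _≡_ (transpose i j)
transpose-involutive i j k = by-cases (k Fin.≟ i) (k Fin.≟ j)
  where
  by-cases : Dec (k ≡ i) → Dec (k ≡ j) → transpose i j (transpose i j k) ≡ k
  by-cases (yes refl) _        = trans (cong (transpose i j) (transpose-matchˡ i j)) (transpose-matchʳ i j)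
  by-cases (no _)     (yes refl) = trans (cong (transpose i j) (transpose-matchʳ i j)) (transpose-matchˡ i j)
  by-cases (no k≢i)   (no k≢j) = trans (cong (transpose i j) (transpose-mismatch k≢i k≢j)) (transpose-mismatch k≢i k≢j)

-- Swapping two adjacent values k, k′ = k + 1 preserves the order of every pair except {k, k′}.
module AdjacentSwap {n : ℕ} {k k′ : Fin n} (adjacent : toℕ k′ ≡ suc (toℕ k)) where

  s : Fin n → Fin n
  s = transpose k k′

  k<k′ : k Fin.< k′
  k<k′ = ≤-reflexive (sym adjacent)

  k≢k′ : k ≢ k′
  k≢k′ = Finₚ.<⇒≢ k<k′

  InPair : Fin n → Set
  InPair z = z ≡ k ⊎ z ≡ k′

  -- No value lies strictly between k and k′, so the two compare alike with any other value.
  <-pair : ∀ {z a b} → z ≢ k → z ≢ k′ → InPair a → InPair b → z Fin.< a → z Fin.< b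
  <-pair z≢k z≢k′ (inj₁ refl) (inj₁ refl) z<a = z<a
  <-pair z≢k z≢k′ (inj₂ refl) (inj₂ refl) z<a = z<a
  <-pair z≢k z≢k′ (inj₁ refl) (inj₂ refl) z<k = <-trans z<k k<k′
  <-pair z≢k z≢k′ (inj₂ refl) (inj₁ refl) z<k′ =
    ≤∧≢⇒< (ℕ.s≤s⁻¹ (subst (_ <_) adjacent z<k′)) (z≢k ∘ Finₚ.toℕ-injective)

  >-pair : ∀ {z a b} → z ≢ k → z ≢ k′ → InPair a → InPair b → a Fin.< z → b Fin.< z
  >-pair z≢k z≢k′ (inj₁ refl) (inj₁ refl) a<z = a<z
  >-pair z≢k z≢k′ (inj₂ refl) (inj₂ refl) a<z = a<z
  >-pair z≢k z≢k′ (inj₂ refl) (inj₁ refl) k′<z = <-trans k<k′ k′<z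
  >-pair z≢k z≢k′ (inj₁ refl) (inj₂ refl) k<z =
    ≤∧≢⇒< (subst (_≤ _) (sym adjacent) k<z) (z≢k′ ∘ sym ∘ Finₚ.toℕ-injective)

  s-pair : ∀ {z} → InPair z → InPair (s z)
  s-pair (inj₁ refl) = inj₂ (transpose-matchˡ k k′)
  s-pair (inj₂ refl) = inj₁ (transpose-matchʳ k k′)

  pair? : ∀ z → (z ≢ k × z ≢ k′) ⊎ InPair z
  pair? z with z Fin.≟ k | z Fin.≟ k′
  ... | yes z≡k | _        = inj₂ (inj₁ z≡k)
  ... | no _    | yes z≡k′ = inj₂ (inj₂ z≡k′)
  ... | no z≢k  | no z≢k′  = inj₁ (z≢k , z≢k′)

  𝟙-<-irrefl : ∀ (z : Fin n) → 𝟙 (z Fin.<? z) ≡ 0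
  𝟙-<-irrefl z = 𝟙-no (z Fin.<? z) (Finₚ.<-irrefl refl)

  s-preserves-< : ∀ a b → ¬ (a ≡ k × b ≡ k′) → ¬ (a ≡ k′ × b ≡ k) → 𝟙 (s a Fin.<? s b) ≡ 𝟙 (a Fin.<? b)
  s-preserves-< a b ¬kk′ ¬k′k with pair? a | pair? b
  ... | inj₁ (a≢k , a≢k′) | inj₁ (b≢k , b≢k′) =
    cong₂ (λ u v → 𝟙 (u Fin.<? v)) (transpose-mismatch a≢k a≢k′) (transpose-mismatch b≢k b≢k′)
  ... | inj₂ a∈ | inj₁ (b≢k , b≢k′) = trans (cong (λ v → 𝟙 (s a Fin.<? v)) (transpose-mismatch b≢k b≢k′))
    (𝟙-cong (s a Fin.<? b) (a Fin.<? b) (>-pair b≢k b≢k′ (s-pair a∈) a∈) (>-pair b≢k b≢k′ a∈ (s-pair a∈)))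
  ... | inj₁ (a≢k , a≢k′) | inj₂ b∈ = trans (cong (λ u → 𝟙 (u Fin.<? s b)) (transpose-mismatch a≢k a≢k′))
    (𝟙-cong (a Fin.<? s b) (a Fin.<? b) (<-pair a≢k a≢k′ (s-pair b∈) b∈) (<-pair a≢k a≢k′ b∈ (s-pair b∈)))
  ... | inj₂ (inj₁ refl) | inj₂ (inj₁ refl) = trans (𝟙-<-irrefl (s a)) (sym (𝟙-<-irrefl a))
  ... | inj₂ (inj₂ refl) | inj₂ (inj₂ refl) = trans (𝟙-<-irrefl (s a)) (sym (𝟙-<-irrefl a))
  ... | inj₂ (inj₁ refl) | inj₂ (inj₂ refl) = ⊥-elim (¬kk′ (refl , refl))
  ... | inj₂ (inj₂ refl) | inj₂ (inj₁ refl) = ⊥-elim (¬k′k (refl , refl))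

  𝟙-<-swap : ∀ a b → 𝟙 (s a Fin.<? s b) + 𝟙 (a Fin.≟ k) * 𝟙 (b Fin.≟ k′) ≡ 𝟙 (a Fin.<? b) + 𝟙 (a Fin.≟ k′) * 𝟙 (b Fin.≟ k)
  𝟙-<-swap a b = begin
    𝟙 (s a Fin.<? s b) + 𝟙 (a Fin.≟ k) * 𝟙 (b Fin.≟ k′)  ≡⟨ cong (𝟙 (s a Fin.<? s b) +_) (𝟙-both k k′) ⟩
    𝟙 (s a Fin.<? s b) + 𝟙 (a Fin.≟ k ×-dec b Fin.≟ k′)
      ≡⟨ by-cases (a Fin.≟ k ×-dec b Fin.≟ k′) (a Fin.≟ k′ ×-dec b Fin.≟ k) ⟩
    𝟙 (a Fin.<? b) + 𝟙 (a Fin.≟ k′ ×-dec b Fin.≟ k)      ≡⟨ cong (𝟙 (a Fin.<? b) +_) (𝟙-both k′ k) ⟨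
    𝟙 (a Fin.<? b) + 𝟙 (a Fin.≟ k′) * 𝟙 (b Fin.≟ k)      ∎
    where
    open ≡-Reasoning
    𝟙-both : ∀ u v → 𝟙 (a Fin.≟ u) * 𝟙 (b Fin.≟ v) ≡ 𝟙 (a Fin.≟ u ×-dec b Fin.≟ v)
    𝟙-both u v = sym (𝟙-× (a Fin.≟ u ×-dec b Fin.≟ v) (a Fin.≟ u) (b Fin.≟ v) proj₁ proj₂ _,_)
    by-cases : (d : Dec (a ≡ k × b ≡ k′)) (e : Dec (a ≡ k′ × b ≡ k)) → 𝟙 (s a Fin.<? s b) + 𝟙 d ≡ 𝟙 (a Fin.<? b) + 𝟙 e
    by-cases (yes (refl , refl)) (yes (k≡k′ , _)) = ⊥-elim (k≢k′ k≡k′)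
    by-cases (yes (refl , refl)) (no _)
      rewrite transpose-matchˡ k k′ | transpose-matchʳ k k′
            | 𝟙-no (k′ Fin.<? k) (<⇒≯ k<k′) | 𝟙-yes (k Fin.<? k′) k<k′ = refl
    by-cases (no _) (yes (refl , refl))
      rewrite transpose-matchˡ k k′ | transpose-matchʳ k k′
            | 𝟙-no (k′ Fin.<? k) (<⇒≯ k<k′) | 𝟙-yes (k Fin.<? k′) k<k′ = refl
    by-cases (no ¬kk′) (no ¬k′k) = cong (_+ 0) (s-preserves-< a b ¬kk′ ¬k′k)

module _ {n : ℕ} (π : Fin n → Fin n) where

  iter-+ : ∀ a b x → iter π (a + b) x ≡ iter π a (iter π b x)
  iter-+ zero    b x = refl
  iter-+ (suc a) b x = cong π (iter-+ a b x)

  iter-comm : ∀ a b x → iter π a (iter π b x) ≡ iter π b (iter π a x)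
  iter-comm a b x = trans (sym (iter-+ a b x)) (trans (cong (λ t → iter π t x) (+-comm a b)) (iter-+ b a x))

  orderFrom-≥ : ∀ x k fuel → k ≤ orderFrom π x k fuel
  orderFrom-≥ x k zero = ≤-refl
  orderFrom-≥ x k (suc fuel) with iter π k x Fin.≟ x
  ... | yes _ = ≤-refl
  ... | no _  = ≤-trans (n≤1+n k) (orderFrom-≥ x (suc k) fuel)

  orderFrom-minimal : ∀ x k fuel t → k ≤ t → t < orderFrom π x k fuel → iter π t x ≢ x
  orderFrom-minimal x k zero t k≤t t< = contradiction k≤t (<⇒≱ t<)
  orderFrom-minimal x k (suc fuel) t k≤t t< with iter π k x Fin.≟ x
  ... | yes _ = contradiction k≤t (<⇒≱ t<)
  ... | no πᵏx≢x with k ℕ.≟ t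
  ...   | yes refl = πᵏx≢x
  ...   | no k≢t   = orderFrom-minimal x (suc k) fuel t (≤∧≢⇒< k≤t k≢t) t<

  orderFrom-returns : ∀ x k fuel t → k ≤ t → t < k + fuel → iter π t x ≡ x →
                      iter π (orderFrom π x k fuel) x ≡ x
  orderFrom-returns x k zero t k≤t t< _ = contradiction k≤t (<⇒≱ (subst (t <_) (+-identityʳ k) t<))
  orderFrom-returns x k (suc fuel) t k≤t t< πᵗx≡x with iter π k x Fin.≟ x
  ... | yes πᵏx≡x = πᵏx≡x
  ... | no πᵏx≢x with k ℕ.≟ t
  ...   | yes refl = ⊥-elim (πᵏx≢x πᵗx≡x)
  ...   | no k≢t   = orderFrom-returns x (suc k) fuel t (≤∧≢⇒< k≤t k≢t) (subst (t <_) (+-suc k fuel) t<) πᵗx≡x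

module Cycles {n : ℕ} (π : Fin n → Fin n) (π-injective : Injective _≡_ _≡_ π) where

  iter-injective : ∀ k {x y} → iter π k x ≡ iter π k y → x ≡ y
  iter-injective zero    e = e
  iter-injective (suc k) e = iter-injective k (π-injective e)

  return-after : ∀ {a b} x → a < b → iter π a x ≡ iter π b x → iter π (b ∸ a) x ≡ x
  return-after {a} {b} x a<b e = iter-injective a (begin
    iter π a (iter π (b ∸ a) x) ≡⟨ iter-comm π a (b ∸ a) x ⟩
    iter π (b ∸ a) (iter π a x) ≡⟨ iter-+ π (b ∸ a) a x ⟨
    iter π (b ∸ a + a) x        ≡⟨ cong (λ t → iter π t x) (m∸n+n≡m (<⇒≤ a<b)) ⟩
    iter π b x                  ≡⟨ e ⟨
    iter π a x                  ∎)
    where open ≡-Reasoning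

  returns-within-n : ∀ x → ∃ λ t → 1 ≤ t × t ≤ n × iter π t x ≡ x
  returns-within-n x with Finₚ.pigeonhole (n<1+n n) (λ (t : Fin (suc n)) → iter π (toℕ t) x)
  ... | a , b , a<b , e = toℕ b ∸ toℕ a , m<n⇒0<n∸m a<b , ≤-trans (m∸n≤m (toℕ b) (toℕ a)) (Finₚ.toℕ≤pred[n] b) , return-after x a<b e

  c : Fin n → ℕ
  c = cycLen π

  cycLen-positive : ∀ x → 1 ≤ c x
  cycLen-positive x = orderFrom-≥ π x 1 n

  cycLen-returns : ∀ x → iter π (c x) x ≡ x
  cycLen-returns x with returns-within-n x
  ... | t , 1≤t , t≤n , πᵗx≡x = orderFrom-returns π x 1 n t 1≤t (s≤s t≤n) πᵗx≡x

  cycLen-minimal : ∀ x t → 1 ≤ t → t < c x → iter π t x ≢ x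
  cycLen-minimal x = orderFrom-minimal π x 1 n

  cycLen-least : ∀ x t → 1 ≤ t → iter π t x ≡ x → c x ≤ t
  cycLen-least x t 1≤t πᵗx≡x = ≮⇒≥ (λ t<c → cycLen-minimal x t 1≤t t<c πᵗx≡x)

  cycLen-≤ : ∀ x → c x ≤ n
  cycLen-≤ x with returns-within-n x
  ... | t , 1≤t , t≤n , πᵗx≡x = ≤-trans (cycLen-least x t 1≤t πᵗx≡x) t≤n

  iter-periodic : ∀ x q r → iter π (q * c x + r) x ≡ iter π r x
  iter-periodic x zero    r = refl
  iter-periodic x (suc q) r = begin
    iter π (c x + q * c x + r) x          ≡⟨ cong (λ t → iter π t x) (+-assoc (c x) (q * c x) r) ⟩
    iter π (c x + (q * c x + r)) x        ≡⟨ iter-+ π (c x) _ x ⟩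
    iter π (c x) (iter π (q * c x + r) x) ≡⟨ cong (iter π (c x)) (iter-periodic x q r) ⟩
    iter π (c x) (iter π r x)             ≡⟨ iter-comm π (c x) r x ⟩
    iter π r (iter π (c x) x)             ≡⟨ cong (iter π r) (cycLen-returns x) ⟩
    iter π r x                            ∎
    where open ≡-Reasoning

  iter-injective-below : ∀ x {a b} → a < c x → b < c x → iter π a x ≡ iter π b x → a ≡ b
  iter-injective-below x {a} {b} a<c b<c e with <-cmp a b
  ... | tri≈ _ a≡b _ = a≡b
  ... | tri< a<b _ _ = ⊥-elim (cycLen-minimal x (b ∸ a) (m<n⇒0<n∸m a<b) (≤-<-trans (m∸n≤m b a) b<c) (return-after x a<b e))
  ... | tri> _ _ b<a = ⊥-elim (cycLen-minimal x (a ∸ b) (m<n⇒0<n∸m b<a) (≤-<-trans (m∸n≤m a b) a<c) (return-after x b<a (sym e)))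

  infix 4 _↝_
  _↝_ : Fin n → Fin n → Set
  x ↝ y = ∃ λ t → iter π t x ≡ y

  ↝-reduce : ∀ {x y} → x ↝ y → ∃ λ t → t < c x × iter π t x ≡ y
  ↝-reduce {x} (t , πᵗx≡y) = t % c x , m%n<n t (c x) , (begin
    iter π (t % c x) x                      ≡⟨ iter-periodic x (t ℕ./ c x) (t % c x) ⟨
    iter π (t ℕ./ c x * c x + t % c x) x    ≡⟨ cong (λ u → iter π u x) (+-comm _ (t % c x)) ⟩
    iter π (t % c x + t ℕ./ c x * c x) x    ≡⟨ cong (λ u → iter π u x) (m≡m%n+[m/n]*n t (c x)) ⟨
    iter π t x                              ≡⟨ πᵗx≡y ⟩
    _                                       ∎)
    where
    open ≡-Reasoning
    instance _ = >-nonZero (cycLen-positive x)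

  ↝-trans : ∀ {x y z} → x ↝ y → y ↝ z → x ↝ z
  ↝-trans {x} (a , refl) (b , refl) = b + a , iter-+ π b a x

  ↝-sym : ∀ {x y} → x ↝ y → y ↝ x
  ↝-sym {x} x↝y with ↝-reduce x↝y
  ... | t , t<c , refl = c x ∸ t , (begin
    iter π (c x ∸ t) (iter π t x) ≡⟨ iter-+ π (c x ∸ t) t x ⟨
    iter π (c x ∸ t + t) x        ≡⟨ cong (λ u → iter π u x) (m∸n+n≡m (<⇒≤ t<c)) ⟩
    iter π (c x) x                ≡⟨ cycLen-returns x ⟩
    x                             ∎)
    where open ≡-Reasoning

  cycLen-iter : ∀ x t → c (iter π t x) ≡ c x
  cycLen-iter x t = ≤-antisym
    (cycLen-least y (c x) (cycLen-positive x) (trans (iter-comm π (c x) t x) (cong (iter π t) (cycLen-returns x))))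
    (cycLen-least x (c y) (cycLen-positive y) (iter-injective t (trans (iter-comm π t (c y) x) (cycLen-returns y))))
    where y = iter π t x

  cycLen-↝ : ∀ {x y} → x ↝ y → c y ≡ c x
  cycLen-↝ {x} (t , refl) = cycLen-iter x t

  -- x ↝ y with the time bounded by the cycle length, hence decidable
  InOrbit : Fin n → Fin n → Set
  InOrbit x y = ∃ λ (t : Fin (c x)) → iter π (toℕ t) x ≡ y

  inOrbit? : ∀ x y → Dec (InOrbit x y)
  inOrbit? x y = Finₚ.any? (λ t → iter π (toℕ t) x Fin.≟ y)

  InOrbit⇒↝ : ∀ {x y} → InOrbit x y → x ↝ y
  InOrbit⇒↝ (t , e) = toℕ t , e

  ↝⇒InOrbit : ∀ {x y} → x ↝ y → InOrbit x y
  ↝⇒InOrbit {x} x↝y with ↝-reduce x↝y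
  ... | t , t<c , e = fromℕ< t<c , trans (cong (λ u → iter π u x) (Finₚ.toℕ-fromℕ< t<c)) e

  𝟙-inOrbit-sym : ∀ x y → 𝟙 (inOrbit? x y) ≡ 𝟙 (inOrbit? y x)
  𝟙-inOrbit-sym x y = 𝟙-cong (inOrbit? x y) (inOrbit? y x)
    (↝⇒InOrbit ∘ ↝-sym ∘ InOrbit⇒↝) (↝⇒InOrbit ∘ ↝-sym ∘ InOrbit⇒↝)

  -- Each point of the orbit of x is iter π t x for exactly one t < cycLen x.
  𝟙-inOrbit : ∀ x y → 𝟙 (inOrbit? x y) ≡ ∑[ t ∈ allFin (c x) ] 𝟙 (iter π (toℕ t) x Fin.≟ y)
  𝟙-inOrbit x y with inOrbit? x y
  ... | yes (t₀ , e₀) = sym (trans (∑-cong (allFin (c x)) same-time) (∑-𝟙-≟ (c x) t₀))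
    where
    same-time : ∀ t → 𝟙 (iter π (toℕ t) x Fin.≟ y) ≡ 𝟙 (t Fin.≟ t₀)
    same-time t = 𝟙-cong (iter π (toℕ t) x Fin.≟ y) (t Fin.≟ t₀)
      (λ e → Finₚ.toℕ-injective (iter-injective-below x (Finₚ.toℕ<n t) (Finₚ.toℕ<n t₀) (trans e (sym e₀))))
      (λ { refl → e₀ })
  ... | no ¬orbit = sym (trans (∑-cong (allFin (c x)) (λ t → 𝟙-no (iter π (toℕ t) x Fin.≟ y) (λ e → ¬orbit (t , e))))
                              (∑-zero (allFin (c x))))

  orbit-size : ∀ x → ∑[ y ∈ allFin n ] 𝟙 (inOrbit? x y) ≡ c x
  orbit-size x = begin
    ∑[ y ∈ allFin n ] 𝟙 (inOrbit? x y)                                       ≡⟨ ∑-cong (allFin n) (𝟙-inOrbit x) ⟩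
    ∑[ y ∈ allFin n ] ∑[ t ∈ allFin (c x) ] 𝟙 (iter π (toℕ t) x Fin.≟ y)      ≡⟨ ∑-swap (allFin n) (allFin (c x)) _ ⟩
    ∑[ t ∈ allFin (c x) ] ∑[ y ∈ allFin n ] 𝟙 (iter π (toℕ t) x Fin.≟ y)
      ≡⟨ ∑-cong (allFin (c x)) (λ t → ∑-𝟙-≟′ n (iter π (toℕ t) x)) ⟩
    ∑[ t ∈ allFin (c x) ] 1                                                  ≡⟨ ∑-allFin-const (c x) 1 ⟩
    c x * 1                                                                  ≡⟨ *-identityʳ (c x) ⟩
    c x                                                                      ∎
    where open ≡-Reasoning

  cycleMin-≤ : ∀ {m y} → IsCycleMin π m → m ↝ y → m Fin.≤ y
  cycleMin-≤ {m} m-min m↝y with ↝-reduce m↝y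
  ... | t , t<c , refl = All.lookup m-min (∈-upTo⁺ (<-≤-trans t<c (cycLen-≤ m)))

  ≤⇒cycleMin : ∀ {m} → (∀ y → m ↝ y → m Fin.≤ y) → IsCycleMin π m
  ≤⇒cycleMin {m} m≤ = All.tabulate (λ {k} _ → m≤ (iter π k m) (k , refl))

  cycleMin-exists : ∀ x → ∃ λ m → x ↝ m × IsCycleMin π m
  cycleMin-exists x = lowest , (t₀ , refl) , ≤⇒cycleMin (λ y lowest↝y → lowest≤ y (↝-trans (t₀ , refl) lowest↝y))
    where
    open import Data.List.Extrema (Finₚ.≤-totalOrder n) using (argmin; f[argmin]≤f[xs])
    t₀ : ℕ
    t₀ = argmin (λ t → iter π t x) 0 (upTo n)
    lowest : Fin n
    lowest = iter π t₀ x
    lowest≤ : ∀ y → x ↝ y → lowest Fin.≤ y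
    lowest≤ y x↝y with ↝-reduce x↝y
    ... | t , t<c , refl = All.lookup (f[argmin]≤f[xs] 0 (upTo n)) (∈-upTo⁺ (<-≤-trans t<c (cycLen-≤ x)))

  cycleMin-unique : ∀ {x m m′} → IsCycleMin π m → IsCycleMin π m′ → x ↝ m → x ↝ m′ → m ≡ m′
  cycleMin-unique m-min m′-min x↝m x↝m′ = Finₚ.≤-antisym
    (cycleMin-≤ m-min (↝-trans (↝-sym x↝m) x↝m′))
    (cycleMin-≤ m′-min (↝-trans (↝-sym x↝m′) x↝m))

  one-cycleMin-per-orbit : ∀ x → ∑[ m ∈ allFin n ] (𝟙 (isCycleMin? π m) * 𝟙 (inOrbit? x m)) ≡ 1
  one-cycleMin-per-orbit x with cycleMin-exists x
  ... | m₀ , x↝m₀ , m₀-min = trans (∑-cong (allFin n) (λ m → sym (is-m₀ m))) (∑-𝟙-≟ n m₀)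
    where
    is-m₀ : ∀ m → 𝟙 (m Fin.≟ m₀) ≡ 𝟙 (isCycleMin? π m) * 𝟙 (inOrbit? x m)
    is-m₀ m = 𝟙-× (m Fin.≟ m₀) (isCycleMin? π m) (inOrbit? x m)
      (λ { refl → m₀-min }) (λ { refl → ↝⇒InOrbit x↝m₀ })
      (λ m-min orbit → cycleMin-unique m-min m₀-min (InOrbit⇒↝ orbit) x↝m₀)

  -- Counting the points of all k-cycles by grouping them around the cycle minima.
  count-cycLen : ∀ k → ∑[ x ∈ allFin n ] 𝟙 (c x ℕ.≟ k)
                       ≡ k * ∑[ m ∈ allFin n ] (𝟙 (isCycleMin? π m) * 𝟙 (c m ℕ.≟ k))
  count-cycLen k = begin
    ∑[ x ∈ allFin n ] len x
      ≡⟨ ∑-cong (allFin n) (λ x → sym (trans (cong (len x *_) (one-cycleMin-per-orbit x)) (*-identityʳ (len x)))) ⟩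
    ∑[ x ∈ allFin n ] (len x * ∑[ m ∈ allFin n ] (min m * orb x m))
      ≡⟨ ∑-cong (allFin n) (λ x → sym (∑-*ˡ (allFin n) (len x) _)) ⟩
    ∑[ x ∈ allFin n ] ∑[ m ∈ allFin n ] (len x * (min m * orb x m))
      ≡⟨ ∑-swap (allFin n) (allFin n) _ ⟩
    ∑[ m ∈ allFin n ] ∑[ x ∈ allFin n ] (len x * (min m * orb x m))
      ≡⟨ ∑-cong (allFin n) (λ m → ∑-cong (allFin n) (λ x → regroup m x)) ⟩
    ∑[ m ∈ allFin n ] ∑[ x ∈ allFin n ] (min m * len m * orb m x)
      ≡⟨ ∑-cong (allFin n) (λ m → trans (∑-*ˡ (allFin n) (min m * len m) _) (cong (min m * len m *_) (orbit-size m))) ⟩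
    ∑[ m ∈ allFin n ] (min m * len m * c m)
      ≡⟨ ∑-cong (allFin n) (λ m → length-k m (c m ℕ.≟ k)) ⟩
    ∑[ m ∈ allFin n ] (k * (min m * len m))
      ≡⟨ ∑-*ˡ (allFin n) k _ ⟩
    k * ∑[ m ∈ allFin n ] (min m * len m) ∎
    where
    open ≡-Reasoning
    len : Fin n → ℕ
    len x = 𝟙 (c x ℕ.≟ k)
    min : Fin n → ℕ
    min m = 𝟙 (isCycleMin? π m)
    orb : Fin n → Fin n → ℕ
    orb x y = 𝟙 (inOrbit? x y)
    len-orb : ∀ x m → len x * orb x m ≡ len m * orb x m
    len-orb x m with inOrbit? x m
    ... | yes orbit = cong (λ l → 𝟙 (l ℕ.≟ k) * 1) (sym (cycLen-↝ (InOrbit⇒↝ orbit)))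
    ... | no _      = trans (*-zeroʳ (len x)) (sym (*-zeroʳ (len m)))
    regroup : ∀ m x → len x * (min m * orb x m) ≡ min m * len m * orb m x
    regroup m x = begin
      len x * (min m * orb x m) ≡⟨ x∙yz≈y∙xz (len x) (min m) (orb x m) ⟩
      min m * (len x * orb x m) ≡⟨ cong (min m *_) (len-orb x m) ⟩
      min m * (len m * orb x m) ≡⟨ *-assoc (min m) (len m) (orb x m) ⟨
      min m * len m * orb x m   ≡⟨ cong (min m * len m *_) (𝟙-inOrbit-sym x m) ⟩
      min m * len m * orb m x   ∎
    length-k : ∀ m (d : Dec (c m ≡ k)) → min m * 𝟙 d * c m ≡ k * (min m * 𝟙 d)
    length-k m (yes refl) = *-comm (min m * 1) (c m)
    length-k m (no _)     = trans (cong (_* c m) (*-zeroʳ (min m))) (sym (trans (cong (k *_) (*-zeroʳ (min m))) (*-zeroʳ k)))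

mult-∑ : ∀ k xs → mult k xs ≡ ∑[ x ∈ xs ] 𝟙 (x ℕ.≟ k)
mult-∑ k = length-filter (ℕ._≟ k)

mult-sort : ∀ k xs → mult k (sort xs) ≡ mult k xs
mult-sort k xs = ↭-length (filter-↭ (ℕ._≟ k) (sort-↭ xs))

mult-cons : ∀ k y ys → mult k (y ∷ ys) ≡ 𝟙 (y ℕ.≟ k) + mult k ys
mult-cons k y ys = trans (mult-∑ k (y ∷ ys)) (cong (𝟙 (y ℕ.≟ k) +_) (sym (mult-∑ k ys)))

mult-head : ∀ y ys → mult y (y ∷ ys) ≢ 0
mult-head y ys = 1+n≢0 ∘ trans (sym (trans (mult-cons y y ys) (cong (_+ mult y ys) (𝟙-yes (y ℕ.≟ y) refl))))

mult-below-head : ∀ {x y ys} → Sorted (y ∷ ys) → x < y → mult x (y ∷ ys) ≡ 0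
mult-below-head {x} {y} {ys} sorted x<y = begin
  mult x (y ∷ ys)                 ≡⟨ mult-∑ x (y ∷ ys) ⟩
  ∑[ z ∈ y ∷ ys ] 𝟙 (z ℕ.≟ x)
    ≡⟨ ∑-cong-All (All.map (λ x<z → 𝟙-no (_ ℕ.≟ x) (>⇒≢ x<z)) (Linked⇒All ≤-trans x<y sorted)) ⟩
  ∑[ z ∈ y ∷ ys ] 0               ≡⟨ ∑-zero (y ∷ ys) ⟩
  0                               ∎
  where open ≡-Reasoning

sorted-unique : ∀ {xs ys} → Sorted xs → Sorted ys → (∀ k → mult k xs ≡ mult k ys) → xs ≡ ys
sorted-unique {[]}     {[]}     _  _  _    = refl
sorted-unique {[]}     {y ∷ ys} _  _  same = ⊥-elim (mult-head y ys (sym (same y)))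
sorted-unique {x ∷ xs} {[]}     _  _  same = ⊥-elim (mult-head x xs (same x))
sorted-unique {x ∷ xs} {y ∷ ys} sx sy same with <-cmp x y
... | tri< x<y _ _ = ⊥-elim (mult-head x xs (trans (same x) (mult-below-head sy x<y)))
... | tri> _ _ y<x = ⊥-elim (mult-head y ys (trans (sym (same y)) (mult-below-head sx y<x)))
... | tri≈ _ refl _ = cong (x ∷_) (sorted-unique (Linked.tail sx) (Linked.tail sy) same-tail)
  where
  same-tail : ∀ k → mult k xs ≡ mult k ys
  same-tail k = +-cancelˡ-≡ (𝟙 (x ℕ.≟ k)) _ _ (trans (sym (mult-cons k x xs)) (trans (same k) (mult-cons k x ys)))

module _ {n : ℕ} where

  IsInjective⇒Injective : {π : Fin n → Fin n} → IsInjective π → Injective _≡_ _≡_ π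
  IsInjective⇒Injective {π} inj {x} {y} = All.lookup (All.lookup inj (∈-allFin x)) (∈-allFin y)

  Injective⇒IsInjective : {π : Fin n → Fin n} → Injective _≡_ _≡_ π → IsInjective π
  Injective⇒IsInjective inj = All.tabulate (λ _ → All.tabulate (λ _ → inj))

  mult-cycleType : ∀ (π : Fin n → Fin n) k →
                   mult k (cycleType π) ≡ ∑[ m ∈ allFin n ] (𝟙 (isCycleMin? π m) * 𝟙 (cycLen π m ℕ.≟ k))
  mult-cycleType π k = begin
    mult k (sort (map (cycLen π) minima))            ≡⟨ mult-sort k (map (cycLen π) minima) ⟩
    mult k (map (cycLen π) minima)                   ≡⟨ mult-∑ k (map (cycLen π) minima) ⟩
    ∑[ l ∈ map (cycLen π) minima ] 𝟙 (l ℕ.≟ k)        ≡⟨ ∑-map (cycLen π) minima _ ⟩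
    ∑[ m ∈ minima ] 𝟙 (cycLen π m ℕ.≟ k)              ≡⟨ ∑-filter (isCycleMin? π) (allFin n) _ ⟩
    ∑[ m ∈ allFin n ] (𝟙 (isCycleMin? π m) * 𝟙 (cycLen π m ℕ.≟ k)) ∎
    where
    open ≡-Reasoning
    minima = filter (isCycleMin? π) (allFin n)

  module _ (π : Fin n → Fin n) (π-injective : Injective _≡_ _≡_ π) where
    open Cycles π π-injective

    count-cycleType : ∀ k → k * mult k (cycleType π) ≡ ∑[ x ∈ allFin n ] 𝟙 (cycLen π x ℕ.≟ k)
    count-cycleType k = trans (cong (k *_) (mult-cycleType π k)) (sym (count-cycLen k))

    mult-zero-cycleType : mult 0 (cycleType π) ≡ 0
    mult-zero-cycleType = begin
      mult 0 (cycleType π)                                           ≡⟨ mult-cycleType π 0 ⟩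
      ∑[ m ∈ allFin n ] (𝟙 (isCycleMin? π m) * 𝟙 (cycLen π m ℕ.≟ 0)) ≡⟨ ∑-cong (allFin n) no-empty-cycle ⟩
      ∑[ m ∈ allFin n ] 0                                            ≡⟨ ∑-zero (allFin n) ⟩
      0                                                              ∎
      where
      open ≡-Reasoning
      no-empty-cycle : ∀ m → 𝟙 (isCycleMin? π m) * 𝟙 (cycLen π m ℕ.≟ 0) ≡ 0
      no-empty-cycle m = trans (cong (𝟙 (isCycleMin? π m) *_) (𝟙-no (cycLen π m ℕ.≟ 0) (λ c≡0 → <⇒≢ (cycLen-positive m) (sym c≡0))))
                               (*-zeroʳ (𝟙 (isCycleMin? π m)))

    𝟙-fixed : ∀ x → 𝟙 (π x Fin.≟ x) ≡ 𝟙 (cycLen π x ℕ.≟ 1)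
    𝟙-fixed x = 𝟙-cong (π x Fin.≟ x) (cycLen π x ℕ.≟ 1)
      (λ πx≡x → ≤-antisym (cycLen-least x 1 ≤-refl πx≡x) (cycLen-positive x))
      (λ c≡1 → subst (λ t → iter π t x ≡ x) c≡1 (cycLen-returns x))

    𝟙-fixed-π² : ∀ x → 𝟙 (π (π x) Fin.≟ x) ≡ 𝟙 (cycLen π x ℕ.≟ 1) + 𝟙 (cycLen π x ℕ.≟ 2)
    𝟙-fixed-π² x with cycLen π x ℕ.≟ 1 | cycLen π x ℕ.≟ 2
    ... | yes c≡1 | c≟2     = trans (𝟙-yes (π (π x) Fin.≟ x) (trans (cong π πx≡x) πx≡x))
                                    (cong (1 +_) (sym (𝟙-no c≟2 (λ c≡2 → contradiction (trans (sym c≡1) c≡2) λ ()))))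
      where πx≡x = subst (λ t → iter π t x ≡ x) c≡1 (cycLen-returns x)
    ... | no _    | yes c≡2 = 𝟙-yes (π (π x) Fin.≟ x) (subst (λ t → iter π t x ≡ x) c≡2 (cycLen-returns x))
    ... | no c≢1  | no c≢2  = 𝟙-no (π (π x) Fin.≟ x)
      (λ π²x≡x → c≢1 (≤-antisym (ℕ.s≤s⁻¹ (≤∧≢⇒< (cycLen-least x 2 (s≤s z≤n) π²x≡x) c≢2)) (cycLen-positive x)))

    count-fixed : ∑[ x ∈ allFin n ] 𝟙 (π x Fin.≟ x) ≡ mult 1 (cycleType π)
    count-fixed = begin
      ∑[ x ∈ allFin n ] 𝟙 (π x Fin.≟ x)          ≡⟨ ∑-cong (allFin n) 𝟙-fixed ⟩
      ∑[ x ∈ allFin n ] 𝟙 (cycLen π x ℕ.≟ 1)     ≡⟨ count-cycleType 1 ⟨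
      1 * mult 1 (cycleType π)                   ≡⟨ *-identityˡ (mult 1 (cycleType π)) ⟩
      mult 1 (cycleType π)                       ∎
      where open ≡-Reasoning

    count-fixed-π² : ∑[ x ∈ allFin n ] 𝟙 (π (π x) Fin.≟ x) ≡ mult 1 (cycleType π) + 2 * mult 2 (cycleType π)
    count-fixed-π² = begin
      ∑[ x ∈ allFin n ] 𝟙 (π (π x) Fin.≟ x)                                 ≡⟨ ∑-cong (allFin n) 𝟙-fixed-π² ⟩
      ∑[ x ∈ allFin n ] (𝟙 (cycLen π x ℕ.≟ 1) + 𝟙 (cycLen π x ℕ.≟ 2))       ≡⟨ ∑-+ (allFin n) _ _ ⟩
      ∑[ x ∈ allFin n ] 𝟙 (cycLen π x ℕ.≟ 1) + ∑[ x ∈ allFin n ] 𝟙 (cycLen π x ℕ.≟ 2)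
        ≡⟨ cong₂ _+_ (count-cycleType 1) (count-cycleType 2) ⟨
      1 * mult 1 (cycleType π) + 2 * mult 2 (cycleType π)
        ≡⟨ cong (_+ 2 * mult 2 (cycleType π)) (*-identityˡ (mult 1 (cycleType π))) ⟩
      mult 1 (cycleType π) + 2 * mult 2 (cycleType π) ∎
      where open ≡-Reasoning

  orderFrom-transport : ∀ {σ π : Fin n → Fin n} {x y} →
    (∀ t → iter σ t x ≡ x → iter π t y ≡ y) → (∀ t → iter π t y ≡ y → iter σ t x ≡ x) →
    ∀ k fuel → orderFrom σ x k fuel ≡ orderFrom π y k fuel
  orderFrom-transport to from k zero = refl
  orderFrom-transport {σ} {π} {x} {y} to from k (suc fuel) with iter σ k x Fin.≟ x | iter π k y Fin.≟ y
  ... | yes _ | yes _ = refl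
  ... | no _  | no _  = orderFrom-transport to from (suc k) fuel
  ... | yes σᵏx≡x | no πᵏy≢y = ⊥-elim (πᵏy≢y (to k σᵏx≡x))
  ... | no σᵏx≢x  | yes πᵏy≡y = ⊥-elim (σᵏx≢x (from k πᵏy≡y))

  iter-cong : ∀ {π π′ : Fin n → Fin n} → π ≗ π′ → ∀ t x → iter π t x ≡ iter π′ t x
  iter-cong π≗π′ zero    x = refl
  iter-cong {π′ = π′} π≗π′ (suc t) x = trans (π≗π′ _) (cong π′ (iter-cong π≗π′ t x))

  cycleType-cong : ∀ {π π′ : Fin n → Fin n} → π ≗ π′ → cycleType π ≡ cycleType π′
  cycleType-cong {π} {π′} π≗π′ = cong sort (trans
    (map-cong cycLen-≗ (filter (isCycleMin? π) (allFin n)))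
    (cong (map (cycLen π′)) (filter-≐ (isCycleMin? π) (isCycleMin? π′) (transfer π≗π′ , transfer (sym ∘ π≗π′)) (allFin n))))
    where
    cycLen-≗ : ∀ x → cycLen π x ≡ cycLen π′ x
    cycLen-≗ x = orderFrom-transport (λ t → trans (sym (iter-cong π≗π′ t x))) (λ t → trans (iter-cong π≗π′ t x)) 1 n
    transfer : ∀ {f g : Fin n → Fin n} → f ≗ g → ∀ {m} → IsCycleMin f m → IsCycleMin g m
    transfer f≗g {m} m-min = All.tabulate (λ {k} k∈ → subst (m Fin.≤_) (iter-cong f≗g k m) (All.lookup m-min k∈))

  conj : (s π : Fin n → Fin n) → Fin n → Fin n
  conj s π = s ∘ π ∘ s

  module _ (s : Fin n → Fin n) (s-involutive : Involutive _≡_ s) where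

    iter-conj : ∀ π t x → iter (conj s π) t x ≡ s (iter π t (s x))
    iter-conj π zero    x = sym (s-involutive x)
    iter-conj π (suc t) x = cong (s ∘ π) (trans (cong s (iter-conj π t x)) (s-involutive _))

    conj-injective : ∀ {π} → Injective _≡_ _≡_ π → Injective _≡_ _≡_ (conj s π)
    conj-injective π-inj {x} {y} e = begin
      x         ≡⟨ s-involutive x ⟨
      s (s x)   ≡⟨ cong s (π-inj (trans (sym (s-involutive _)) (trans (cong s e) (s-involutive _)))) ⟩
      s (s y)   ≡⟨ s-involutive y ⟩
      y         ∎
      where open ≡-Reasoning

    conj-involutive : ∀ π → conj s (conj s π) ≗ π
    conj-involutive π x = trans (s-involutive _) (cong π (s-involutive x))

    cycLen-conj : ∀ π x → cycLen (conj s π) x ≡ cycLen π (s x)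
    cycLen-conj π x = orderFrom-transport
      (λ t e → trans (sym (s-involutive _)) (cong s (trans (sym (iter-conj π t x)) e)))
      (λ t e → trans (iter-conj π t x) (trans (cong s e) (s-involutive x)))
      1 n

    -- k · mult k counts the points on k-cycles, and conjugation by s merely relabels the points.
    cycleType-conj : ∀ {π} → Injective _≡_ _≡_ π → cycleType (conj s π) ≡ cycleType π
    cycleType-conj {π} π-inj = sorted-unique (sort-↗ (map (cycLen (conj s π)) (filter (isCycleMin? (conj s π)) (allFin n))))
                                   (sort-↗ (map (cycLen π) (filter (isCycleMin? π) (allFin n)))) same-mult
      where
      σ-inj = conj-injective π-inj
      same-mult : ∀ k → mult k (cycleType (conj s π)) ≡ mult k (cycleType π)
      same-mult zero    = trans (mult-zero-cycleType (conj s π) σ-inj) (sym (mult-zero-cycleType π π-inj))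
      same-mult (suc k) = *-cancelˡ-≡ _ _ (suc k) (begin
        suc k * mult (suc k) (cycleType (conj s π))      ≡⟨ count-cycleType (conj s π) σ-inj (suc k) ⟩
        ∑[ x ∈ allFin n ] 𝟙 (cycLen (conj s π) x ℕ.≟ suc k)
          ≡⟨ ∑-cong (allFin n) (λ x → cong (λ l → 𝟙 (l ℕ.≟ suc k)) (cycLen-conj π x)) ⟩
        ∑[ x ∈ allFin n ] 𝟙 (cycLen π (s x) ℕ.≟ suc k)      ≡⟨ ∑-allFin-involution n s s-involutive _ ⟨
        ∑[ x ∈ allFin n ] 𝟙 (cycLen π x ℕ.≟ suc k)          ≡⟨ count-cycleType π π-inj (suc k) ⟨
        suc k * mult (suc k) (cycleType π)               ∎)
        where open ≡-Reasoning

module ConjugacyClass (n : ℕ) (lam : List ℕ) where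

  Cλ : List (Fin n → Fin n)
  Cλ = C n lam

  hasType? : (π : Fin n → Fin n) → Dec (cycleType π ≡ lam)
  hasType? π = ≡-dec ℕ._≟_ (cycleType π) lam

  members : All (λ π → Injective _≡_ _≡_ π × cycleType π ≡ lam) Cλ
  members = All.zip (All.map IsInjective⇒Injective (Allₚ.filter⁺ hasType? (Allₚ.all-filter isInjective? (allFuns n n))) ,
                     Allₚ.all-filter hasType? (Sym n))

  ∑-Cλ-cong : ∀ {w v : (Fin n → Fin n) → ℕ} →
              (∀ π → Injective _≡_ _≡_ π → cycleType π ≡ lam → w π ≡ v π) → ∑ Cλ w ≡ ∑ Cλ v
  ∑-Cλ-cong w≡v = ∑-cong-All (All.map (λ (inj , type) → w≡v _ inj type) members)

  ∑-Cλ-unfold : ∀ w → ∑ Cλ w ≡ ∑[ π ∈ allFuns n n ] (𝟙 (isInjective? π) * (𝟙 (hasType? π) * w π))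
  ∑-Cλ-unfold w = trans (∑-filter hasType? (Sym n) w) (∑-filter isInjective? (allFuns n n) _)

  -- Conjugation by an involution permutes C_λ.
  ∑-Cλ-conj : ∀ s → Involutive _≡_ s → (w : (Fin n → Fin n) → ℕ) → (∀ {π π′} → π ≗ π′ → w π ≡ w π′) →
              ∑ Cλ w ≡ ∑ Cλ (w ∘ conj s)
  ∑-Cλ-conj s s-inv w w-resp = begin
    ∑ Cλ w                                                                        ≡⟨ ∑-Cλ-unfold w ⟩
    ∑ (allFuns n n) weight
      ≡⟨ ∑-involution (allFuns n n) _≗_ _≗?_ (allFuns-once n n) (conj s) conj-swap weight weight-resp ⟩
    ∑ (allFuns n n) (weight ∘ conj s)                                             ≡⟨ ∑-cong (allFuns n n) weight-conj ⟩
    ∑[ π ∈ allFuns n n ] (𝟙 (isInjective? π) * (𝟙 (hasType? π) * w (conj s π))) ≡⟨ ∑-Cλ-unfold (w ∘ conj s) ⟨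
    ∑ Cλ (w ∘ conj s)                                                             ∎
    where
    open ≡-Reasoning
    weight : (Fin n → Fin n) → ℕ
    weight π = 𝟙 (isInjective? π) * (𝟙 (hasType? π) * w π)
    inj⇔ : ∀ {π π′} → π ≗ π′ → IsInjective π → IsInjective π′
    inj⇔ π≗π′ inj = Injective⇒IsInjective (λ e → IsInjective⇒Injective inj (trans (π≗π′ _) (trans e (sym (π≗π′ _)))))
    weight-resp : ∀ π π′ → π ≗ π′ → weight π ≡ weight π′
    weight-resp π π′ π≗π′ = cong₂ _*_
      (𝟙-cong (isInjective? π) (isInjective? π′) (inj⇔ π≗π′) (inj⇔ (sym ∘ π≗π′)))
      (cong₂ _*_ (cong (λ t → 𝟙 (≡-dec ℕ._≟_ t lam)) (cycleType-cong π≗π′)) (w-resp π≗π′))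
    conj-swap : ∀ π π′ → π′ ≗ conj s π → π ≗ conj s π′
    conj-swap π π′ π′≗sπs x = sym (trans (cong s (π′≗sπs (s x))) (conj-involutive s s-inv π x))
    conj-inj : ∀ {π} → IsInjective π → IsInjective (conj s π)
    conj-inj inj = Injective⇒IsInjective (conj-injective s s-inv (IsInjective⇒Injective inj))
    weight-conj : ∀ π → weight (conj s π) ≡ 𝟙 (isInjective? π) * (𝟙 (hasType? π) * w (conj s π))
    weight-conj π with isInjective? π
    ... | yes inj = begin
      weight (conj s π)                              ≡⟨ cong (_* (𝟙 (hasType? (conj s π)) * w (conj s π)))
                                                           (𝟙-yes (isInjective? (conj s π)) (conj-inj inj)) ⟩
      1 * (𝟙 (hasType? (conj s π)) * w (conj s π))   ≡⟨ cong (λ t → 1 * (𝟙 (≡-dec ℕ._≟_ t lam) * w (conj s π)))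
                                                           (cycleType-conj s s-inv (IsInjective⇒Injective inj)) ⟩
      1 * (𝟙 (hasType? π) * w (conj s π))            ∎
    ... | no ¬inj = cong (_* (𝟙 (hasType? (conj s π)) * w (conj s π)))
                         (𝟙-no (isInjective? (conj s π)) (¬inj ∘ inj⇔ (conj-involutive s s-inv π) ∘ conj-inj))

  F p q : ℕ
  F = length Cλ
  p = mult 1 lam
  q = mult 2 lam

  #[_↦_] : Fin n → Fin n → ℕ
  #[ x ↦ a ] = ∑[ π ∈ Cλ ] 𝟙 (π x Fin.≟ a)

  #[_↦_,_↦_] : Fin n → Fin n → Fin n → Fin n → ℕ
  #[ x ↦ a , y ↦ b ] = ∑[ π ∈ Cλ ] (𝟙 (π x Fin.≟ a) * 𝟙 (π y Fin.≟ b))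

  #[_↦²_] : Fin n → Fin n → ℕ
  #[ x ↦² a ] = ∑[ π ∈ Cλ ] 𝟙 (π (π x) Fin.≟ a)

  #desc : Fin n → Fin n → ℕ
  #desc x y = ∑[ π ∈ Cλ ] 𝟙 (π y Fin.<? π x)

  fixed-points : ∀ {π} → Injective _≡_ _≡_ π → cycleType π ≡ lam → ∑[ x ∈ allFin n ] 𝟙 (π x Fin.≟ x) ≡ p
  fixed-points {π} inj type = trans (count-fixed π inj) (cong (mult 1) type)

  fixed-points-π² : ∀ {π} → Injective _≡_ _≡_ π → cycleType π ≡ lam → ∑[ x ∈ allFin n ] 𝟙 (π (π x) Fin.≟ x) ≡ p + 2 * q
  fixed-points-π² {π} inj type = trans (count-fixed-π² π inj) (cong (λ l → mult 1 l + 2 * mult 2 l) type)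

  module _ (u v : Fin n) where
    private
      s = transpose u v
      s-inv = transpose-involutive u v

    private
      conj-at : ∀ π x → conj s π (s x) ≡ s (π x)
      conj-at π x = cong (s ∘ π) (s-inv x)

      𝟙-s≟s : ∀ a b → 𝟙 (s a Fin.≟ s b) ≡ 𝟙 (a Fin.≟ b)
      𝟙-s≟s a b = 𝟙-cong (s a Fin.≟ s b) (a Fin.≟ b) (λ e → trans (sym (s-inv a)) (trans (cong s e) (s-inv b))) (cong s)

      𝟙-conj : ∀ π x a → 𝟙 (conj s π (s x) Fin.≟ s a) ≡ 𝟙 (π x Fin.≟ a)
      𝟙-conj π x a = trans (cong (λ y → 𝟙 (y Fin.≟ s a)) (conj-at π x)) (𝟙-s≟s (π x) a)

    #↦-relabel : ∀ {x a x′ a′} → s x ≡ x′ → s a ≡ a′ → #[ x′ ↦ a′ ] ≡ #[ x ↦ a ]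
    #↦-relabel {x} {a} refl refl = trans
      (∑-Cλ-conj s s-inv (λ π → 𝟙 (π (s x) Fin.≟ s a)) (λ π≗π′ → cong (λ u → 𝟙 (u Fin.≟ s a)) (π≗π′ (s x))))
      (∑-cong Cλ (λ π → 𝟙-conj π x a))

    #↦↦-relabel : ∀ {x a y b x′ a′ y′ b′} → s x ≡ x′ → s a ≡ a′ → s y ≡ y′ → s b ≡ b′ →
                  #[ x′ ↦ a′ , y′ ↦ b′ ] ≡ #[ x ↦ a , y ↦ b ]
    #↦↦-relabel {x} {a} {y} {b} refl refl refl refl = trans
      (∑-Cλ-conj s s-inv (λ π → 𝟙 (π (s x) Fin.≟ s a) * 𝟙 (π (s y) Fin.≟ s b))
        (λ π≗π′ → cong₂ (λ u v → 𝟙 (u Fin.≟ s a) * 𝟙 (v Fin.≟ s b)) (π≗π′ (s x)) (π≗π′ (s y))))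
      (∑-cong Cλ (λ π → cong₂ _*_ (𝟙-conj π x a) (𝟙-conj π y b)))

    #↦²-relabel : ∀ {x x′} → s x ≡ x′ → #[ x′ ↦² x′ ] ≡ #[ x ↦² x ]
    #↦²-relabel {x} refl = trans
      (∑-Cλ-conj s s-inv (λ π → 𝟙 (π (π (s x)) Fin.≟ s x))
        (λ {π} {π′} π≗π′ → cong (λ u → 𝟙 (u Fin.≟ s x)) (trans (π≗π′ _) (cong π′ (π≗π′ (s x))))))
      (∑-cong Cλ (λ π → trans (cong (λ u → 𝟙 (u Fin.≟ s x)) (trans (cong (conj s π) (conj-at π x)) (conj-at π (π x))))
                              (𝟙-s≟s (π (π x)) x)))

    #desc-relabel : ∀ x y → #desc (s x) (s y) ≡ ∑[ π ∈ Cλ ] 𝟙 (s (π y) Fin.<? s (π x))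
    #desc-relabel x y = trans
      (∑-Cλ-conj s s-inv (λ π → 𝟙 (π (s y) Fin.<? π (s x)))
        (λ π≗π′ → cong₂ (λ u v → 𝟙 (u Fin.<? v)) (π≗π′ (s y)) (π≗π′ (s x))))
      (∑-cong Cλ (λ π → cong₂ (λ u v → 𝟙 (u Fin.<? v)) (conj-at π y) (conj-at π x)))

  ∑-#↦-diagonal : ∑[ x ∈ allFin n ] #[ x ↦ x ] ≡ F * p
  ∑-#↦-diagonal = begin
    ∑[ x ∈ allFin n ] ∑[ π ∈ Cλ ] 𝟙 (π x Fin.≟ x) ≡⟨ ∑-swap (allFin n) Cλ _ ⟩
    ∑[ π ∈ Cλ ] ∑[ x ∈ allFin n ] 𝟙 (π x Fin.≟ x) ≡⟨ ∑-Cλ-cong (λ π → fixed-points) ⟩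
    ∑[ π ∈ Cλ ] p                                 ≡⟨ ∑-const Cλ p ⟩
    F * p                                         ∎
    where open ≡-Reasoning

  ∑-#↦²-diagonal : ∑[ x ∈ allFin n ] #[ x ↦² x ] ≡ F * (p + 2 * q)
  ∑-#↦²-diagonal = begin
    ∑[ x ∈ allFin n ] ∑[ π ∈ Cλ ] 𝟙 (π (π x) Fin.≟ x) ≡⟨ ∑-swap (allFin n) Cλ _ ⟩
    ∑[ π ∈ Cλ ] ∑[ x ∈ allFin n ] 𝟙 (π (π x) Fin.≟ x) ≡⟨ ∑-Cλ-cong (λ π → fixed-points-π²) ⟩
    ∑[ π ∈ Cλ ] (p + 2 * q)                           ≡⟨ ∑-const Cλ (p + 2 * q) ⟩
    F * (p + 2 * q)                                   ∎
    where open ≡-Reasoning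

  ∑-#↦ : ∀ x → ∑[ a ∈ allFin n ] #[ x ↦ a ] ≡ F
  ∑-#↦ x = begin
    ∑[ a ∈ allFin n ] ∑[ π ∈ Cλ ] 𝟙 (π x Fin.≟ a)          ≡⟨ ∑-swap (allFin n) Cλ _ ⟩
    ∑[ π ∈ Cλ ] ∑[ a ∈ allFin n ] 𝟙 (π x Fin.≟ a)          ≡⟨ ∑-cong Cλ (λ π → ∑-𝟙-≟′ n (π x)) ⟩
    ∑[ π ∈ Cλ ] 1                                          ≡⟨ ∑-const Cλ 1 ⟩
    F * 1                                                  ≡⟨ *-identityʳ F ⟩
    F                                                      ∎
    where open ≡-Reasoning

  ∑-#↦↦-fixed : ∀ x → ∑[ y ∈ allFin n ] #[ x ↦ x , y ↦ y ] ≡ p * #[ x ↦ x ]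
  ∑-#↦↦-fixed x = begin
    ∑[ y ∈ allFin n ] ∑[ π ∈ Cλ ] (𝟙 (π x Fin.≟ x) * 𝟙 (π y Fin.≟ y))  ≡⟨ ∑-swap (allFin n) Cλ _ ⟩
    ∑[ π ∈ Cλ ] ∑[ y ∈ allFin n ] (𝟙 (π x Fin.≟ x) * 𝟙 (π y Fin.≟ y))
      ≡⟨ ∑-cong Cλ (λ π → ∑-*ˡ (allFin n) (𝟙 (π x Fin.≟ x)) (λ y → 𝟙 (π y Fin.≟ y))) ⟩
    ∑[ π ∈ Cλ ] (𝟙 (π x Fin.≟ x) * ∑[ y ∈ allFin n ] 𝟙 (π y Fin.≟ y))
      ≡⟨ ∑-Cλ-cong (λ π inj type → cong (𝟙 (π x Fin.≟ x) *_) (fixed-points inj type)) ⟩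
    ∑[ π ∈ Cλ ] (𝟙 (π x Fin.≟ x) * p)                                   ≡⟨ ∑-*ʳ Cλ p _ ⟩
    #[ x ↦ x ] * p                                                      ≡⟨ *-comm _ p ⟩
    p * #[ x ↦ x ]                                                      ∎
    where open ≡-Reasoning

  ∑-#↦↦-2-cycle : ∀ x → ∑[ y ∈ allFin n ] #[ x ↦ y , y ↦ x ] ≡ #[ x ↦² x ]
  ∑-#↦↦-2-cycle x = trans (∑-swap (allFin n) Cλ _) (∑-cong Cλ (λ π → ∑-pick′ n (π x) (λ y → 𝟙 (π y Fin.≟ x))))

  ∑-#↦↦-first : ∀ x y b → ∑[ a ∈ allFin n ] #[ x ↦ a , y ↦ b ] ≡ #[ y ↦ b ]
  ∑-#↦↦-first x y b = trans (∑-swap (allFin n) Cλ _) (∑-cong Cλ (λ π → ∑-pick′ n (π x) (λ _ → 𝟙 (π y Fin.≟ b))))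

  ∑-#↦↦-second : ∀ x a y → ∑[ b ∈ allFin n ] #[ x ↦ a , y ↦ b ] ≡ #[ x ↦ a ]
  ∑-#↦↦-second x a y = trans (∑-swap (allFin n) Cλ _) (∑-cong Cλ (λ π → begin
    ∑[ b ∈ allFin n ] (𝟙 (π x Fin.≟ a) * 𝟙 (π y Fin.≟ b))   ≡⟨ ∑-*ˡ (allFin n) (𝟙 (π x Fin.≟ a)) (λ b → 𝟙 (π y Fin.≟ b)) ⟩
    𝟙 (π x Fin.≟ a) * ∑[ b ∈ allFin n ] 𝟙 (π y Fin.≟ b)     ≡⟨ cong (𝟙 (π x Fin.≟ a) *_) (∑-𝟙-≟′ n (π y)) ⟩
    𝟙 (π x Fin.≟ a) * 1                                     ≡⟨ *-identityʳ (𝟙 (π x Fin.≟ a)) ⟩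
    𝟙 (π x Fin.≟ a)                                         ∎))
    where open ≡-Reasoning

  #↦↦-collision : ∀ {x y} → x ≢ y → ∀ a → #[ x ↦ a , y ↦ a ] ≡ 0
  #↦↦-collision {x} {y} x≢y a = trans (∑-Cλ-cong (λ π inj _ → both π inj)) (∑-zero Cλ)
    where
    both : ∀ π → Injective _≡_ _≡_ π → 𝟙 (π x Fin.≟ a) * 𝟙 (π y Fin.≟ a) ≡ 0
    both π inj with π x Fin.≟ a | π y Fin.≟ a
    ... | yes πx≡a | yes πy≡a = ⊥-elim (x≢y (inj (trans πx≡a (sym πy≡a))))
    ... | yes _    | no _     = refl
    ... | no _     | _        = refl

  #↦↦-diagonal : ∀ x a → #[ x ↦ a , x ↦ a ] ≡ #[ x ↦ a ]
  #↦↦-diagonal x a = ∑-cong Cλ (λ π → 𝟙-idem (π x Fin.≟ a))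

  #↦-diagonal-uniform : ∀ x i → #[ x ↦ x ] ≡ #[ i ↦ i ]
  #↦-diagonal-uniform x i = sym (#↦-relabel x i (transpose-matchˡ x i) (transpose-matchˡ x i))

  #↦²-diagonal-uniform : ∀ x i → #[ x ↦² x ] ≡ #[ i ↦² i ]
  #↦²-diagonal-uniform x i = sym (#↦²-relabel x i (transpose-matchˡ x i))

  fixed-count : ∀ i → n * #[ i ↦ i ] ≡ F * p
  fixed-count i = begin
    n * #[ i ↦ i ]                ≡⟨ ∑-allFin-const n #[ i ↦ i ] ⟨
    ∑[ x ∈ allFin n ] #[ i ↦ i ]  ≡⟨ ∑-cong (allFin n) (λ x → #↦-diagonal-uniform x i) ⟨
    ∑[ x ∈ allFin n ] #[ x ↦ x ]  ≡⟨ ∑-#↦-diagonal ⟩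
    F * p                         ∎
    where open ≡-Reasoning

  fixed²-count : ∀ i → n * #[ i ↦² i ] ≡ F * (p + 2 * q)
  fixed²-count i = begin
    n * #[ i ↦² i ]                ≡⟨ ∑-allFin-const n #[ i ↦² i ] ⟨
    ∑[ x ∈ allFin n ] #[ i ↦² i ]  ≡⟨ ∑-cong (allFin n) (λ x → #↦²-diagonal-uniform x i) ⟨
    ∑[ x ∈ allFin n ] #[ x ↦² x ]  ≡⟨ ∑-#↦²-diagonal ⟩
    F * (p + 2 * q)                ∎
    where open ≡-Reasoning

  module _ {i j : Fin n} (i≢j : i ≢ j) where

    fixed-fixed-count : p * #[ i ↦ i ] + #[ i ↦ i , j ↦ j ] ≡ #[ i ↦ i ] + n * #[ i ↦ i , j ↦ j ]
    fixed-fixed-count = begin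
      p * #[ i ↦ i ] + #[ i ↦ i , j ↦ j ]                          ≡⟨ cong (_+ #[ i ↦ i , j ↦ j ]) (∑-#↦↦-fixed i) ⟨
      ∑[ y ∈ allFin n ] #[ i ↦ i , y ↦ y ] + #[ i ↦ i , j ↦ j ]    ≡⟨ ∑-all-but-one n _ i _ uniform ⟩
      #[ i ↦ i , i ↦ i ] + n * #[ i ↦ i , j ↦ j ]                  ≡⟨ cong (_+ n * #[ i ↦ i , j ↦ j ]) (#↦↦-diagonal i i) ⟩
      #[ i ↦ i ] + n * #[ i ↦ i , j ↦ j ]                          ∎
      where
      open ≡-Reasoning
      uniform : ∀ y → y ≢ i → #[ i ↦ i , y ↦ y ] ≡ #[ i ↦ i , j ↦ j ]
      uniform y y≢i = sym (#↦↦-relabel y j (transpose-mismatch (y≢i ∘ sym) i≢j) (transpose-mismatch (y≢i ∘ sym) i≢j)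
                                           (transpose-matchˡ y j) (transpose-matchˡ y j))

    two-cycle-count : #[ i ↦² i ] + #[ i ↦ j , j ↦ i ] ≡ #[ i ↦ i ] + n * #[ i ↦ j , j ↦ i ]
    two-cycle-count = begin
      #[ i ↦² i ] + #[ i ↦ j , j ↦ i ]                              ≡⟨ cong (_+ #[ i ↦ j , j ↦ i ]) (∑-#↦↦-2-cycle i) ⟨
      ∑[ y ∈ allFin n ] #[ i ↦ y , y ↦ i ] + #[ i ↦ j , j ↦ i ]     ≡⟨ ∑-all-but-one n _ i _ uniform ⟩
      #[ i ↦ i , i ↦ i ] + n * #[ i ↦ j , j ↦ i ]                   ≡⟨ cong (_+ n * #[ i ↦ j , j ↦ i ]) (#↦↦-diagonal i i) ⟩
      #[ i ↦ i ] + n * #[ i ↦ j , j ↦ i ]                           ∎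
      where
      open ≡-Reasoning
      uniform : ∀ y → y ≢ i → #[ i ↦ y , y ↦ i ] ≡ #[ i ↦ j , j ↦ i ]
      uniform y y≢i = sym (#↦↦-relabel y j (transpose-mismatch (y≢i ∘ sym) i≢j) (transpose-matchˡ y j)
                                           (transpose-matchˡ y j) (transpose-mismatch (y≢i ∘ sym) i≢j))

    moved-count : F + #[ i ↦ j ] ≡ #[ i ↦ i ] + n * #[ i ↦ j ]
    moved-count = begin
      F + #[ i ↦ j ]                         ≡⟨ cong (_+ #[ i ↦ j ]) (∑-#↦ i) ⟨
      ∑[ a ∈ allFin n ] #[ i ↦ a ] + #[ i ↦ j ] ≡⟨ ∑-all-but-one n _ i _ uniform ⟩
      #[ i ↦ i ] + n * #[ i ↦ j ]            ∎
      where
      open ≡-Reasoning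
      uniform : ∀ a → a ≢ i → #[ i ↦ a ] ≡ #[ i ↦ j ]
      uniform a a≢i = sym (#↦-relabel a j (transpose-mismatch (a≢i ∘ sym) i≢j) (transpose-matchˡ a j))

    module _ {a : Fin n} (a≢i : a ≢ i) (a≢j : a ≢ j) where

      moved-fixed-count : #[ i ↦ i ] + 2 * #[ i ↦ a , j ↦ j ] ≡ #[ i ↦ i , j ↦ j ] + n * #[ i ↦ a , j ↦ j ]
      moved-fixed-count = begin
        #[ i ↦ i ] + 2 * #[ i ↦ a , j ↦ j ]
          ≡⟨ cong (_+ 2 * #[ i ↦ a , j ↦ j ]) (trans (∑-#↦↦-first i j j) (#↦-diagonal-uniform j i)) ⟨
        ∑[ b ∈ allFin n ] #[ i ↦ b , j ↦ j ] + 2 * #[ i ↦ a , j ↦ j ]       ≡⟨ ∑-all-but-two n _ i j _ i≢j uniform ⟩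
        #[ i ↦ i , j ↦ j ] + #[ i ↦ j , j ↦ j ] + n * #[ i ↦ a , j ↦ j ]
          ≡⟨ cong (λ t → #[ i ↦ i , j ↦ j ] + t + n * #[ i ↦ a , j ↦ j ]) (#↦↦-collision i≢j j) ⟩
        #[ i ↦ i , j ↦ j ] + 0 + n * #[ i ↦ a , j ↦ j ]
          ≡⟨ cong (_+ n * #[ i ↦ a , j ↦ j ]) (+-identityʳ _) ⟩
        #[ i ↦ i , j ↦ j ] + n * #[ i ↦ a , j ↦ j ]                         ∎
        where
        open ≡-Reasoning
        uniform : ∀ b → b ≢ i → b ≢ j → #[ i ↦ b , j ↦ j ] ≡ #[ i ↦ a , j ↦ j ]
        uniform b b≢i b≢j = sym (#↦↦-relabel b a fixes-i (transpose-matchˡ b a) fixes-j fixes-j)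
          where
          fixes-i = transpose-mismatch (b≢i ∘ sym) (a≢i ∘ sym)
          fixes-j = transpose-mismatch (b≢j ∘ sym) (a≢j ∘ sym)

      swapped-moved-count : #[ i ↦ j ] + 2 * #[ i ↦ j , j ↦ a ] ≡ #[ i ↦ j , j ↦ i ] + n * #[ i ↦ j , j ↦ a ]
      swapped-moved-count = begin
        #[ i ↦ j ] + 2 * #[ i ↦ j , j ↦ a ]
          ≡⟨ cong (_+ 2 * #[ i ↦ j , j ↦ a ]) (∑-#↦↦-second i j j) ⟨
        ∑[ b ∈ allFin n ] #[ i ↦ j , j ↦ b ] + 2 * #[ i ↦ j , j ↦ a ]       ≡⟨ ∑-all-but-two n _ i j _ i≢j uniform ⟩
        #[ i ↦ j , j ↦ i ] + #[ i ↦ j , j ↦ j ] + n * #[ i ↦ j , j ↦ a ]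
          ≡⟨ cong (λ t → #[ i ↦ j , j ↦ i ] + t + n * #[ i ↦ j , j ↦ a ]) (#↦↦-collision i≢j j) ⟩
        #[ i ↦ j , j ↦ i ] + 0 + n * #[ i ↦ j , j ↦ a ]
          ≡⟨ cong (_+ n * #[ i ↦ j , j ↦ a ]) (+-identityʳ _) ⟩
        #[ i ↦ j , j ↦ i ] + n * #[ i ↦ j , j ↦ a ]                         ∎
        where
        open ≡-Reasoning
        uniform : ∀ b → b ≢ i → b ≢ j → #[ i ↦ j , j ↦ b ] ≡ #[ i ↦ j , j ↦ a ]
        uniform b b≢i b≢j = sym (#↦↦-relabel b a fixes-i fixes-j fixes-j (transpose-matchˡ b a))
          where
          fixes-i = transpose-mismatch (b≢i ∘ sym) (a≢i ∘ sym)
          fixes-j = transpose-mismatch (b≢j ∘ sym) (a≢j ∘ sym)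

  I≡#desc : ∀ x y → I n lam x y ≡ #desc x y
  I≡#desc x y = length-filter (λ π → π y Fin.<? π x) Cλ

  #↦↦-comm : ∀ x a y b → #[ x ↦ a , y ↦ b ] ≡ #[ y ↦ b , x ↦ a ]
  #↦↦-comm x a y b = ∑-cong Cλ (λ π → *-comm (𝟙 (π x Fin.≟ a)) (𝟙 (π y Fin.≟ b)))

  desc-complement : ∀ {x y} → x ≢ y → #desc x y + #desc y x ≡ F
  desc-complement {x} {y} x≢y = begin
    #desc x y + #desc y x                                 ≡⟨ ∑-+ Cλ _ _ ⟨
    ∑[ π ∈ Cλ ] (𝟙 (π y Fin.<? π x) + 𝟙 (π x Fin.<? π y)) ≡⟨ ∑-Cλ-cong (λ π inj _ → one-order π inj) ⟩
    ∑[ π ∈ Cλ ] 1                                         ≡⟨ ∑-const Cλ 1 ⟩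
    F * 1                                                 ≡⟨ *-identityʳ F ⟩
    F                                                     ∎
    where
    open ≡-Reasoning
    one-order : ∀ π → Injective _≡_ _≡_ π → 𝟙 (π y Fin.<? π x) + 𝟙 (π x Fin.<? π y) ≡ 1
    one-order π inj with Finₚ.<-cmp (π y) (π x)
    ... | tri< πy<πx _ πx≮πy = cong₂ _+_ (𝟙-yes (π y Fin.<? π x) πy<πx) (𝟙-no (π x Fin.<? π y) πx≮πy)
    ... | tri> πy≮πx _ πx<πy = cong₂ _+_ (𝟙-no (π y Fin.<? π x) πy≮πx) (𝟙-yes (π x Fin.<? π y) πx<πy)
    ... | tri≈ _ πy≡πx _     = ⊥-elim (x≢y (inj (sym πy≡πx)))

  desc-adjacent-swap : ∀ {k k′} → toℕ k′ ≡ suc (toℕ k) → ∀ x y →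
    #desc (transpose k k′ x) (transpose k k′ y) + #[ y ↦ k , x ↦ k′ ] ≡ #desc x y + #[ y ↦ k′ , x ↦ k ]
  desc-adjacent-swap {k} {k′} adjacent x y = begin
    #desc (s x) (s y) + #[ y ↦ k , x ↦ k′ ]
      ≡⟨ cong (_+ #[ y ↦ k , x ↦ k′ ]) (#desc-relabel k k′ x y) ⟩
    ∑[ π ∈ Cλ ] 𝟙 (s (π y) Fin.<? s (π x)) + #[ y ↦ k , x ↦ k′ ]     ≡⟨ ∑-+ Cλ _ _ ⟨
    ∑[ π ∈ Cλ ] (𝟙 (s (π y) Fin.<? s (π x)) + 𝟙 (π y Fin.≟ k) * 𝟙 (π x Fin.≟ k′))
      ≡⟨ ∑-cong Cλ (λ π → 𝟙-<-swap (π y) (π x)) ⟩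
    ∑[ π ∈ Cλ ] (𝟙 (π y Fin.<? π x) + 𝟙 (π y Fin.≟ k′) * 𝟙 (π x Fin.≟ k)) ≡⟨ ∑-+ Cλ _ _ ⟩
    #desc x y + #[ y ↦ k′ , x ↦ k ]                                  ∎
    where
    open ≡-Reasoning
    open AdjacentSwap adjacent using (s; 𝟙-<-swap)

open import Data.Integer using (ℤ; +_) renaming (_+_ to _+ℤ_; _*_ to _*ℤ_; _-_ to _-ℤ_)
open import Data.Integer.Properties using (+-inverseʳ; i-j≡0⇒i≡j; pos-+; pos-*)
open import Data.Integer.Tactic.RingSolver using (solve-∀; solve)
open import Data.Rational using (_/_; 1ℚ; toℚᵘ) renaming (_+_ to _+ℚ_; _*_ to _*ℚ_)
open import Data.Rational.Properties using (toℚᵘ-injective; toℚᵘ-fromℚᵘ; toℚᵘ-homo-+; toℚᵘ-homo-*)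
open import Data.Rational.Unnormalised as ℚᵘ using (mkℚᵘ; *≡*; _≃_)
import Data.Rational.Unnormalised.Properties as ℚᵘₚ

-- L ≡ R follows from a combination X ≡ Y of hypotheses when L − R = X − Y is a ring identity.
by-combination : ∀ {L R X Y : ℤ} → X ≡ Y → L +ℤ Y ≡ R +ℤ X → L ≡ R
by-combination {L} {R} {X} refl e = i-j≡0⇒i≡j L R (begin
  L -ℤ R                ≡⟨ shift L R X ⟩
  (L +ℤ X) -ℤ (R +ℤ X)  ≡⟨ cong (_-ℤ (R +ℤ X)) e ⟩
  (R +ℤ X) -ℤ (R +ℤ X)  ≡⟨ +-inverseʳ (R +ℤ X) ⟩
  + 0                   ∎)
  where
  open ≡-Reasoning
  shift : ∀ L R X → L -ℤ R ≡ (L +ℤ X) -ℤ (R +ℤ X)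
  shift = solve-∀

module _ (n F p q : ℤ) where

  solve-fixed-fixed : ∀ a A → n *ℤ a ≡ F *ℤ p → p *ℤ a +ℤ A ≡ a +ℤ n *ℤ A →
                n *ℤ (n -ℤ + 1) *ℤ A ≡ F *ℤ p *ℤ (p -ℤ + 1)
  solve-fixed-fixed a A ha hA = by-combination
    (cong₂ _+ℤ_ (cong ((p -ℤ + 1) *ℤ_) ha) (cong (n *ℤ_) (sym hA)))
    (solve (n ∷ F ∷ p ∷ a ∷ A ∷ []))

  solve-two-cycle : ∀ a b B → n *ℤ a ≡ F *ℤ p → n *ℤ b ≡ F *ℤ (p +ℤ + 2 *ℤ q) → b +ℤ B ≡ a +ℤ n *ℤ B →
                  n *ℤ (n -ℤ + 1) *ℤ B ≡ + 2 *ℤ q *ℤ F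
  solve-two-cycle a b B ha hb hB = by-combination
    (cong₂ _+ℤ_ (cong₂ _+ℤ_ hb (sym ha)) (cong (n *ℤ_) (sym hB)))
    (solve (n ∷ F ∷ p ∷ q ∷ a ∷ b ∷ B ∷ []))

  solve-moved : ∀ a h → n *ℤ a ≡ F *ℤ p → F +ℤ h ≡ a +ℤ n *ℤ h → n *ℤ (n -ℤ + 1) *ℤ h ≡ F *ℤ (n -ℤ p)
  solve-moved a h ha hh = by-combination
    (cong₂ _+ℤ_ (cong (n *ℤ_) (sym hh)) (sym ha))
    (solve (n ∷ F ∷ p ∷ a ∷ h ∷ []))

  solve-moved-fixed : ∀ a A D → n *ℤ a ≡ F *ℤ p → n *ℤ (n -ℤ + 1) *ℤ A ≡ F *ℤ p *ℤ (p -ℤ + 1) → a +ℤ + 2 *ℤ D ≡ A +ℤ n *ℤ D →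
                n *ℤ (n -ℤ + 1) *ℤ (n -ℤ + 2) *ℤ D ≡ F *ℤ p *ℤ (n -ℤ p)
  solve-moved-fixed a A D ha hA hD = by-combination
    (cong₂ _+ℤ_ (cong₂ _+ℤ_ (cong (n *ℤ (n -ℤ + 1) *ℤ_) (sym hD)) (cong ((n -ℤ + 1) *ℤ_) ha)) (sym hA))
    (solve (n ∷ F ∷ p ∷ a ∷ A ∷ D ∷ []))

  solve-swapped-moved : ∀ B h D → n *ℤ (n -ℤ + 1) *ℤ B ≡ + 2 *ℤ q *ℤ F → n *ℤ (n -ℤ + 1) *ℤ h ≡ F *ℤ (n -ℤ p) →
                  h +ℤ + 2 *ℤ D ≡ B +ℤ n *ℤ D →
                  n *ℤ (n -ℤ + 1) *ℤ (n -ℤ + 2) *ℤ D ≡ F *ℤ (n -ℤ p -ℤ + 2 *ℤ q)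
  solve-swapped-moved B h D hB hh hD = by-combination
    (cong₂ _+ℤ_ (cong₂ _+ℤ_ (cong (n *ℤ (n -ℤ + 1) *ℤ_) (sym hD)) hh) (sym hB))
    (solve (n ∷ F ∷ p ∷ q ∷ B ∷ h ∷ D ∷ []))

  solve-descents-adjacent : ∀ A B I I′ → n *ℤ (n -ℤ + 1) *ℤ A ≡ F *ℤ p *ℤ (p -ℤ + 1) → n *ℤ (n -ℤ + 1) *ℤ B ≡ + 2 *ℤ q *ℤ F →
                  I +ℤ A ≡ I′ +ℤ B → I +ℤ I′ ≡ F →
                  + 2 *ℤ (n *ℤ (n -ℤ + 1) *ℤ (n -ℤ + 2)) *ℤ I
                    ≡ F *ℤ (n *ℤ (n -ℤ + 1) *ℤ (n -ℤ + 2) +ℤ (n -ℤ + 2) *ℤ (+ 2 *ℤ q -ℤ p *ℤ (p -ℤ + 1))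
                            +ℤ + 2 *ℤ + 0 *ℤ ((n -ℤ p) *ℤ (+ 1 -ℤ p) -ℤ + 2 *ℤ q))
  solve-descents-adjacent A B I I′ hA hB hI hC = by-combination
    (cong₂ _+ℤ_ (cong₂ _+ℤ_ (cong (n *ℤ (n -ℤ + 1) *ℤ (n -ℤ + 2) *ℤ_) hI) (cong (n *ℤ (n -ℤ + 1) *ℤ (n -ℤ + 2) *ℤ_) hC))
                (cong₂ _+ℤ_ (cong ((n -ℤ + 2) *ℤ_) hB) (cong ((n -ℤ + 2) *ℤ_) (sym hA))))
    (solve (n ∷ F ∷ p ∷ q ∷ A ∷ B ∷ I ∷ I′ ∷ []))

  solve-descents-next : ∀ t I I′ D₁ D₂ →
                  + 2 *ℤ (n *ℤ (n -ℤ + 1) *ℤ (n -ℤ + 2)) *ℤ I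
                    ≡ F *ℤ (n *ℤ (n -ℤ + 1) *ℤ (n -ℤ + 2) +ℤ (n -ℤ + 2) *ℤ (+ 2 *ℤ q -ℤ p *ℤ (p -ℤ + 1))
                            +ℤ + 2 *ℤ t *ℤ ((n -ℤ p) *ℤ (+ 1 -ℤ p) -ℤ + 2 *ℤ q)) →
                  I′ +ℤ D₁ ≡ I +ℤ D₂ →
                  n *ℤ (n -ℤ + 1) *ℤ (n -ℤ + 2) *ℤ D₁ ≡ F *ℤ p *ℤ (n -ℤ p) →
                  n *ℤ (n -ℤ + 1) *ℤ (n -ℤ + 2) *ℤ D₂ ≡ F *ℤ (n -ℤ p -ℤ + 2 *ℤ q) →
                  + 2 *ℤ (n *ℤ (n -ℤ + 1) *ℤ (n -ℤ + 2)) *ℤ I′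
                    ≡ F *ℤ (n *ℤ (n -ℤ + 1) *ℤ (n -ℤ + 2) +ℤ (n -ℤ + 2) *ℤ (+ 2 *ℤ q -ℤ p *ℤ (p -ℤ + 1))
                            +ℤ + 2 *ℤ (t +ℤ + 1) *ℤ ((n -ℤ p) *ℤ (+ 1 -ℤ p) -ℤ + 2 *ℤ q))
  solve-descents-next t I I′ D₁ D₂ hI hs hD₁ hD₂ = by-combination
    (cong₂ _+ℤ_ (cong₂ _+ℤ_ (cong (+ 2 *ℤ (n *ℤ (n -ℤ + 1) *ℤ (n -ℤ + 2)) *ℤ_) hs) hI)
                (cong₂ _+ℤ_ (cong (+ 2 *ℤ_) hD₂) (cong (+ 2 *ℤ_) (sym hD₁))))
    (solve (n ∷ F ∷ p ∷ q ∷ t ∷ I ∷ I′ ∷ D₁ ∷ D₂ ∷ []))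

/-≃ : ∀ (i : ℤ) m → toℚᵘ (i / suc m) ≃ mkℚᵘ i m
/-≃ i m = toℚᵘ-fromℚᵘ (mkℚᵘ i m)

clear-denominators : ∀ (I F : ℕ) (X Z : ℤ) (a b : ℕ) (e : ℤ) → + suc b ≡ + suc a *ℤ e →
  + 2 *ℤ + suc b *ℤ + I ≡ + F *ℤ (+ suc b +ℤ e *ℤ X +ℤ Z) →
  (+ I) / 1 ≡ ((+ F) / 2) *ℚ (1ℚ +ℚ X / suc a +ℚ Z / suc b)
clear-denominators I F X Z a b e hb hI =
  toℚᵘ-injective (ℚᵘₚ.≃-trans (/-≃ (+ I) 0) (ℚᵘₚ.≃-sym (ℚᵘₚ.≃-trans as-ℚᵘ (ℚᵘₚ.≃-sym cross-multiplied))))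
  where
  d₂ d₃ : ℤ
  d₂ = + suc a
  d₃ = + suc b
  as-ℚᵘ : toℚᵘ (((+ F) / 2) *ℚ (1ℚ +ℚ X / suc a +ℚ Z / suc b))
          ≃ mkℚᵘ (+ F) 1 ℚᵘ.* (mkℚᵘ (+ 1) 0 ℚᵘ.+ mkℚᵘ X a ℚᵘ.+ mkℚᵘ Z b)
  as-ℚᵘ = ℚᵘₚ.≃-trans (toℚᵘ-homo-* ((+ F) / 2) _) (ℚᵘₚ.*-cong (/-≃ (+ F) 1)
            (ℚᵘₚ.≃-trans (toℚᵘ-homo-+ (1ℚ +ℚ X / suc a) (Z / suc b))
              (ℚᵘₚ.+-cong (ℚᵘₚ.≃-trans (toℚᵘ-homo-+ 1ℚ (X / suc a)) (ℚᵘₚ.+-cong ℚᵘₚ.≃-refl (/-≃ X a))) (/-≃ Z b))))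
  identity : ∀ I F X Z d₂ d₃ e → d₃ ≡ d₂ *ℤ e → + 2 *ℤ d₃ *ℤ I ≡ F *ℤ (d₃ +ℤ e *ℤ X +ℤ Z) →
             I *ℤ (+ 2 *ℤ (d₂ *ℤ d₃)) ≡ F *ℤ ((+ 1 *ℤ d₂ +ℤ X *ℤ + 1) *ℤ d₃ +ℤ Z *ℤ d₂) *ℤ + 1
  identity I F X Z d₂ d₃ e hb hI = by-combination
    (cong₂ _+ℤ_ (cong (d₂ *ℤ_) hI) (cong (F *ℤ X *ℤ_) (sym hb)))
    (solve (I ∷ F ∷ X ∷ Z ∷ d₂ ∷ d₃ ∷ e ∷ []))
  denominator : + (2 * (1 * suc a * suc b)) ≡ + 2 *ℤ (d₂ *ℤ d₃)
  denominator = trans (pos-* 2 (1 * suc a * suc b))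
                      (cong (+ 2 *ℤ_) (trans (pos-* (1 * suc a) (suc b)) (cong (λ k → + k *ℤ d₃) (*-identityˡ (suc a)))))
  cross-multiplied : mkℚᵘ (+ I) 0 ≃ mkℚᵘ (+ F) 1 ℚᵘ.* (mkℚᵘ (+ 1) 0 ℚᵘ.+ mkℚᵘ X a ℚᵘ.+ mkℚᵘ Z b)
  cross-multiplied = *≡* (begin
    + I *ℤ + (2 * (1 * suc a * suc b))                                      ≡⟨ cong (+ I *ℤ_) denominator ⟩
    + I *ℤ (+ 2 *ℤ (d₂ *ℤ d₃))                                              ≡⟨ identity (+ I) (+ F) X Z d₂ d₃ e hb hI ⟩
    + F *ℤ ((+ 1 *ℤ d₂ +ℤ X *ℤ + 1) *ℤ d₃ +ℤ Z *ℤ d₂) *ℤ + 1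
      ≡⟨ cong (λ k → + F *ℤ ((+ 1 *ℤ d₂ +ℤ X *ℤ + 1) *ℤ d₃ +ℤ Z *ℤ + k) *ℤ + 1) (*-identityˡ (suc a)) ⟨
    + F *ℤ ((+ 1 *ℤ d₂ +ℤ X *ℤ + 1) *ℤ d₃ +ℤ Z *ℤ + (1 * suc a)) *ℤ + 1     ∎)
    where open ≡-Reasoning

lift-≡ : ∀ {a b : ℕ} {A B : ℤ} → + a ≡ A → + b ≡ B → a ≡ b → A ≡ B
lift-≡ ea eb e = trans (sym ea) (trans (cong +_ e) eb)

pos-+-* : ∀ a b c → + (a + b * c) ≡ + a +ℤ + b *ℤ + c
pos-+-* a b c = trans (pos-+ a (b * c)) (cong ((+ a) +ℤ_) (pos-* b c))

module Descents (m : ℕ) (lam : List ℕ) where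

  n : ℕ
  n = 3 + m

  open ConjugacyClass n lam

  ℤN₃ ℤn ℤF ℤp ℤq : ℤ
  ℤn = + n
  ℤF = + F
  ℤp = + p
  ℤq = + q
  ℤN₃ = ℤn *ℤ (ℤn -ℤ + 1) *ℤ (ℤn -ℤ + 2)

  ℤX ℤY : ℤ
  ℤX = + 2 *ℤ ℤq -ℤ ℤp *ℤ (ℤp -ℤ + 1)
  ℤY = (ℤn -ℤ ℤp) *ℤ (+ 1 -ℤ ℤp) -ℤ + 2 *ℤ ℤq

  -- the claimed value of I(i, j) for j − i = t + 1, with denominators cleared
  DescentFormula : ℕ → ℤ → Set
  DescentFormula I t = + 2 *ℤ ℤN₃ *ℤ + I ≡ ℤF *ℤ (ℤN₃ +ℤ (ℤn -ℤ + 2) *ℤ ℤX +ℤ + 2 *ℤ t *ℤ ℤY)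

  fixedℤ : ∀ i → ℤn *ℤ + #[ i ↦ i ] ≡ ℤF *ℤ ℤp
  fixedℤ i = lift-≡ (pos-* n #[ i ↦ i ]) (pos-* F p) (fixed-count i)

  fixed²ℤ : ∀ i → ℤn *ℤ + #[ i ↦² i ] ≡ ℤF *ℤ (ℤp +ℤ + 2 *ℤ ℤq)
  fixed²ℤ i = lift-≡ (pos-* n #[ i ↦² i ]) (trans (pos-* F (p + 2 * q)) (cong (ℤF *ℤ_) (pos-+-* p 2 q))) (fixed²-count i)

  module _ {i j : Fin n} (i≢j : i ≢ j) where

    fixed-fixedℤ : ℤn *ℤ (ℤn -ℤ + 1) *ℤ + #[ i ↦ i , j ↦ j ] ≡ ℤF *ℤ ℤp *ℤ (ℤp -ℤ + 1)
    fixed-fixedℤ = solve-fixed-fixed ℤn ℤF ℤp ℤq (+ #[ i ↦ i ]) (+ #[ i ↦ i , j ↦ j ]) (fixedℤ i)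
      (lift-≡ (trans (pos-+ (p * #[ i ↦ i ]) #[ i ↦ i , j ↦ j ]) (cong (_+ℤ + #[ i ↦ i , j ↦ j ]) (pos-* p #[ i ↦ i ])))
            (pos-+-* #[ i ↦ i ] n #[ i ↦ i , j ↦ j ]) (fixed-fixed-count i≢j))

    two-cycleℤ : ℤn *ℤ (ℤn -ℤ + 1) *ℤ + #[ i ↦ j , j ↦ i ] ≡ + 2 *ℤ ℤq *ℤ ℤF
    two-cycleℤ = solve-two-cycle ℤn ℤF ℤp ℤq (+ #[ i ↦ i ]) (+ #[ i ↦² i ]) (+ #[ i ↦ j , j ↦ i ]) (fixedℤ i) (fixed²ℤ i)
      (lift-≡ (pos-+ #[ i ↦² i ] #[ i ↦ j , j ↦ i ]) (pos-+-* #[ i ↦ i ] n #[ i ↦ j , j ↦ i ]) (two-cycle-count i≢j))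

    movedℤ : ℤn *ℤ (ℤn -ℤ + 1) *ℤ + #[ i ↦ j ] ≡ ℤF *ℤ (ℤn -ℤ ℤp)
    movedℤ = solve-moved ℤn ℤF ℤp ℤq (+ #[ i ↦ i ]) (+ #[ i ↦ j ]) (fixedℤ i)
      (lift-≡ (pos-+ F #[ i ↦ j ]) (pos-+-* #[ i ↦ i ] n #[ i ↦ j ]) (moved-count i≢j))

    module _ {a : Fin n} (a≢i : a ≢ i) (a≢j : a ≢ j) where

      moved-fixedℤ : ℤN₃ *ℤ + #[ i ↦ a , j ↦ j ] ≡ ℤF *ℤ ℤp *ℤ (ℤn -ℤ ℤp)
      moved-fixedℤ = solve-moved-fixed ℤn ℤF ℤp ℤq (+ #[ i ↦ i ]) (+ #[ i ↦ i , j ↦ j ]) (+ #[ i ↦ a , j ↦ j ]) (fixedℤ i) fixed-fixedℤ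
        (lift-≡ (pos-+-* #[ i ↦ i ] 2 #[ i ↦ a , j ↦ j ]) (pos-+-* #[ i ↦ i , j ↦ j ] n #[ i ↦ a , j ↦ j ])
              (moved-fixed-count i≢j a≢i a≢j))

      swapped-movedℤ : ℤN₃ *ℤ + #[ i ↦ j , j ↦ a ] ≡ ℤF *ℤ (ℤn -ℤ ℤp -ℤ + 2 *ℤ ℤq)
      swapped-movedℤ = solve-swapped-moved ℤn ℤF ℤp ℤq (+ #[ i ↦ j , j ↦ i ]) (+ #[ i ↦ j ]) (+ #[ i ↦ j , j ↦ a ]) two-cycleℤ movedℤ
        (lift-≡ (pos-+-* #[ i ↦ j ] 2 #[ i ↦ j , j ↦ a ]) (pos-+-* #[ i ↦ j , j ↦ i ] n #[ i ↦ j , j ↦ a ])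
              (swapped-moved-count i≢j a≢i a≢j))

  descents-adjacent : ∀ {i i′ : Fin n} → toℕ i′ ≡ suc (toℕ i) → DescentFormula (#desc i i′) (+ 0)
  descents-adjacent {i} {i′} adjacent = solve-descents-adjacent ℤn ℤF ℤp ℤq
    (+ #[ i ↦ i , i′ ↦ i′ ]) (+ #[ i ↦ i′ , i′ ↦ i ]) (+ #desc i i′) (+ #desc i′ i)
    (fixed-fixedℤ i≢i′) (two-cycleℤ i≢i′)
    (lift-≡ (pos-+ (#desc i i′) #[ i ↦ i , i′ ↦ i′ ]) (pos-+ (#desc i′ i) #[ i ↦ i′ , i′ ↦ i ]) swap-step)
    (lift-≡ (pos-+ (#desc i i′) (#desc i′ i)) refl (desc-complement i≢i′))
    where
    i≢i′ : i ≢ i′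
    i≢i′ e = 1+n≢n (trans (sym adjacent) (cong toℕ (sym e)))
    swap-step : #desc i i′ + #[ i ↦ i , i′ ↦ i′ ] ≡ #desc i′ i + #[ i ↦ i′ , i′ ↦ i ]
    swap-step = trans (cong₂ (λ x y → #desc x y + #[ i ↦ i , i′ ↦ i′ ]) (sym (transpose-matchʳ i i′)) (sym (transpose-matchˡ i i′)))
                      (desc-adjacent-swap adjacent i′ i)

  descents-next : ∀ {i j j′ : Fin n} {t} → toℕ j′ ≡ suc (toℕ j) → i ≢ j → i ≢ j′ →
                  DescentFormula (#desc i j) (+ t) → DescentFormula (#desc i j′) (+ suc t)
  descents-next {i} {j} {j′} {t} adjacent i≢j i≢j′ formula = subst (DescentFormula (#desc i j′)) (+1≡suc t)
    (solve-descents-next ℤn ℤF ℤp ℤq (+ t) (+ #desc i j) (+ #desc i j′) (+ #[ i ↦ j′ , j ↦ j ]) (+ #[ i ↦ j , j ↦ j′ ])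
      formula
      (lift-≡ (pos-+ (#desc i j′) #[ i ↦ j′ , j ↦ j ]) (pos-+ (#desc i j) #[ i ↦ j , j ↦ j′ ]) swap-step)
      (moved-fixedℤ i≢j j′≢i j′≢j) (swapped-movedℤ i≢j j′≢i j′≢j))
    where
    +1≡suc : ∀ t → + t +ℤ + 1 ≡ + suc t
    +1≡suc t = trans (sym (pos-+ t 1)) (cong +_ (+-comm t 1))
    j′≢i : j′ ≢ i
    j′≢i = i≢j′ ∘ sym
    j′≢j : j′ ≢ j
    j′≢j e = 1+n≢n (trans (sym adjacent) (cong toℕ e))
    swap-step : #desc i j′ + #[ i ↦ j′ , j ↦ j ] ≡ #desc i j + #[ i ↦ j , j ↦ j′ ]
    swap-step = begin
      #desc i j′ + #[ i ↦ j′ , j ↦ j ]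
        ≡⟨ cong₂ (λ x y → #desc x y + #[ i ↦ j′ , j ↦ j ]) (transpose-mismatch i≢j i≢j′) (transpose-matchˡ j j′) ⟨
      #desc (transpose j j′ i) (transpose j j′ j) + #[ i ↦ j′ , j ↦ j ]
        ≡⟨ cong (λ c → #desc (transpose j j′ i) (transpose j j′ j) + c) (#↦↦-comm i j′ j j) ⟩
      #desc (transpose j j′ i) (transpose j j′ j) + #[ j ↦ j , i ↦ j′ ] ≡⟨ desc-adjacent-swap adjacent i j ⟩
      #desc i j + #[ j ↦ j′ , i ↦ j ]                                   ≡⟨ cong (λ c → #desc i j + c) (#↦↦-comm j j′ i j) ⟩
      #desc i j + #[ i ↦ j , j ↦ j′ ]                                   ∎
      where open ≡-Reasoning

  descents : ∀ i t (lt : suc (toℕ i) + t < n) → DescentFormula (#desc i (fromℕ< lt)) (+ t)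
  descents i zero    lt = descents-adjacent (trans (Finₚ.toℕ-fromℕ< lt) (+-identityʳ (suc (toℕ i))))
  descents i (suc t) lt =
    descents-next {t = t} adjacent (i≢ (t , Finₚ.toℕ-fromℕ< lt′)) (i≢ (suc t , Finₚ.toℕ-fromℕ< lt)) (descents i t lt′)
    where
    lt′ : suc (toℕ i) + t < n
    lt′ = ≤-<-trans (+-monoʳ-≤ (suc (toℕ i)) (n≤1+n t)) lt
    adjacent : toℕ (fromℕ< lt) ≡ suc (toℕ (fromℕ< lt′))
    adjacent = trans (Finₚ.toℕ-fromℕ< lt) (trans (+-suc (suc (toℕ i)) t) (cong suc (sym (Finₚ.toℕ-fromℕ< lt′))))
    i≢ : ∀ {j} → (∃ λ u → toℕ j ≡ suc (toℕ i) + u) → i ≢ j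
    i≢ (u , e) refl = 1+n≰n (≤-trans (m≤m+n (suc (toℕ i)) u) (≤-reflexive (sym e)))

  -- n − 1 and n − 2 are computed exactly in both ℕ and ℤ, since n = 3 + m.
  denominator-split : + (n * (n ∸ 1) * (n ∸ 2)) ≡ + (n * (n ∸ 1)) *ℤ (ℤn -ℤ + 2)
  denominator-split = pos-* (n * (n ∸ 1)) (n ∸ 2)

  denominator≡ℤN₃ : + (n * (n ∸ 1) * (n ∸ 2)) ≡ ℤN₃
  denominator≡ℤN₃ = trans denominator-split (cong (_*ℤ (ℤn -ℤ + 2)) (pos-* n (n ∸ 1)))

  descents-between : ∀ (i j : Fin n) → i Fin.< j →
    + 2 *ℤ + (n * (n ∸ 1) * (n ∸ 2)) *ℤ + I n lam i j
    ≡ ℤF *ℤ (+ (n * (n ∸ 1) * (n ∸ 2)) +ℤ (ℤn -ℤ + 2) *ℤ ℤX +ℤ + 2 *ℤ ((+ toℕ j -ℤ + toℕ i) -ℤ + 1) *ℤ ℤY)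
  descents-between i j i<j = begin
    + 2 *ℤ + (n * (n ∸ 1) * (n ∸ 2)) *ℤ + I n lam i j
      ≡⟨ cong₂ (λ d k → + 2 *ℤ d *ℤ + k) denominator≡ℤN₃ (trans (I≡#desc i j) (cong (#desc i) (sym j≡))) ⟩
    + 2 *ℤ ℤN₃ *ℤ + #desc i (fromℕ< lt)
      ≡⟨ descents i t lt ⟩
    ℤF *ℤ (ℤN₃ +ℤ (ℤn -ℤ + 2) *ℤ ℤX +ℤ + 2 *ℤ + t *ℤ ℤY)
      ≡⟨ cong₂ (λ d g → ℤF *ℤ (d +ℤ (ℤn -ℤ + 2) *ℤ ℤX +ℤ + 2 *ℤ g *ℤ ℤY)) (sym denominator≡ℤN₃) (sym gap) ⟩
    ℤF *ℤ (+ (n * (n ∸ 1) * (n ∸ 2)) +ℤ (ℤn -ℤ + 2) *ℤ ℤX +ℤ + 2 *ℤ ((+ toℕ j -ℤ + toℕ i) -ℤ + 1) *ℤ ℤY) ∎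
    where
    open ≡-Reasoning
    t = toℕ j ∸ suc (toℕ i)
    j-split : suc (toℕ i) + t ≡ toℕ j
    j-split = m+[n∸m]≡n i<j
    lt : suc (toℕ i) + t < n
    lt = subst (_< n) (sym j-split) (Finₚ.toℕ<n j)
    j≡ : fromℕ< lt ≡ j
    j≡ = Finₚ.toℕ-injective (trans (Finₚ.toℕ-fromℕ< lt) j-split)
    gap : (+ toℕ j -ℤ + toℕ i) -ℤ + 1 ≡ + t
    gap = begin
      (+ toℕ j -ℤ + toℕ i) -ℤ + 1                        ≡⟨ cong (λ k → (+ k -ℤ + toℕ i) -ℤ + 1) (sym j-split) ⟩
      (+ (suc (toℕ i) + t) -ℤ + toℕ i) -ℤ + 1
        ≡⟨ cong (λ k → (k -ℤ + toℕ i) -ℤ + 1) (trans (pos-+ (suc (toℕ i)) t) (cong (_+ℤ + t) (pos-+ 1 (toℕ i)))) ⟩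
      (+ 1 +ℤ + toℕ i +ℤ + t -ℤ + toℕ i) -ℤ + 1          ≡⟨ cancel (+ toℕ i) (+ t) ⟩
      + t                                                ∎
      where
      cancel : ∀ a b → (+ 1 +ℤ a +ℤ b -ℤ a) -ℤ + 1 ≡ b
      cancel = solve-∀

-- The proof never uses that λ is a partition of n: the identity holds for every list λ.
lemma6p1 : (n : ℕ) (h : 3 ≤ n) (lam : List ℕ) → lam ⊢ n →
    (i j : Fin n) → i Fin.< j →
    let p = mult 1 lam
        q = mult 2 lam
    in (+ I n lam i j) / 1
       ≡ ((+ length (C n lam)) / 2) *ℚ
         (1ℚ
          +ℚ _/_ ((+ 2 *ℤ + q) -ℤ (+ p *ℤ (+ p -ℤ + 1))) (n * (n ∸ 1)) {{nz₂ n h}}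
          +ℚ _/_ (+ 2 *ℤ ((+ toℕ j -ℤ + toℕ i) -ℤ + 1)
                   *ℤ (((+ n -ℤ + p) *ℤ (+ 1 -ℤ + p)) -ℤ (+ 2 *ℤ + q)))
                (n * (n ∸ 1) * (n ∸ 2)) {{nz₃ n h}})
lemma6p1 (suc (suc (suc m))) _ lam _ i j i<j =
  clear-denominators (I n lam i j) (length (C n lam)) ℤX (+ 2 *ℤ ((+ toℕ j -ℤ + toℕ i) -ℤ + 1) *ℤ ℤY) _ _ (ℤn -ℤ + 2)
    denominator-split (descents-between i j i<j)
  where open Descents m lam
lemma6p1 (suc (suc zero)) (s≤s (s≤s ())) _ _ _ _ _
lemma6p1 (suc zero) (s≤s ()) _ _ _ _ _
lemma6p1 zero () _ _ _ _ _
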